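{- Let $fr(\pi)$ denote the number of pairs $i<j$ with $\pi_i<\pi_j$ (occurrences of the pattern $12$). Then $$\sum_{n\ge0}\sum_{\pi\in\mathfrak M_n}x^nq^{fr(\pi)}=\cfrac{1}{1-x-\cfrac{x^2q}{1-xq-\cfrac{x^2q^3}{1-xq^2-\cfrac{x^2q^5}{\ddots}}}},$$ in which the $n$-th numerator is $x^2q^{2n-1}$ and the $n$-th denominator is $1-xq^{n-1}$ ($n\ge1$).
   Context: A permutation $\pi=\pi_1\cdots\pi_n$ is a Motzkin permutation if it avoids the pattern $132$ (no $i<j<k$ with $\pi_i<\pi_k<\pi_j$) and there are no indices $a<b$ with $\pi_a<\pi_b<\pi_{b+1}$; $\mathfrak M_n$ is the set of them. -}

module Defs where

open import Data.Nat as ℕ using (ℕ; zero; suc; _+_; _*_; _∸_)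
open import Data.Fin as F using (Fin; toℕ)
open import Data.Fin.Properties as FP using (all?)
open import Data.Vec using (Vec; []; _∷_; lookup)
open import Data.List using (List; []; _∷_; [_]; length; filter; map; concatMap; cartesianProduct; allFin)
open import Data.Product using (_×_; _,_; proj₁; proj₂)
open import Data.Empty using (⊥)
open import Relation.Binary.PropositionalEquality using (_≡_)
open import Relation.Nullary using (Dec; yes; no; ¬_)
open import Relation.Nullary.Decidable using (_×-dec_; _→-dec_)

-- Permutations of [n] are represented by their one-line notation
-- π : Fin n → Fin n (π i is the value in position i), required injective.

IsPerm : {n : ℕ} → (Fin n → Fin n) → Set
IsPerm {n} π = ∀ (i j : Fin n) → π i ≡ π j → i ≡ j

Avoids132 : {n : ℕ} → (Fin n → Fin n) → Set
Avoids132 {n} π = ∀ (i j k : Fin n) → i F.< j → j F.< k →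
  π i F.< π k → π k F.< π j → ⊥

NoAdj : {n : ℕ} → (Fin n → Fin n) → Set
NoAdj {n} π = ∀ (a b c : Fin n) → a F.< b → toℕ c ≡ suc (toℕ b) →
  π a F.< π b → π b F.< π c → ⊥

IsMotzkin : {n : ℕ} → (Fin n → Fin n) → Set
IsMotzkin π = IsPerm π × Avoids132 π × NoAdj π

private
  no⊥ : Dec ⊥
  no⊥ = no (λ ())

isPerm? : {n : ℕ} → (π : Fin n → Fin n) → Dec (IsPerm π)
isPerm? π = all? λ i → all? λ j → (π i F.≟ π j) →-dec (i F.≟ j)

avoids132? : {n : ℕ} → (π : Fin n → Fin n) → Dec (Avoids132 π)
avoids132? π = all? λ i → all? λ j → all? λ k →
  (i FP.<? j) →-dec (j FP.<? k) →-dec (π i FP.<? π k) →-dec (π k FP.<? π j) →-dec no⊥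

noAdj? : {n : ℕ} → (π : Fin n → Fin n) → Dec (NoAdj π)
noAdj? π = all? λ a → all? λ b → all? λ c →
  (a FP.<? b) →-dec (toℕ c ℕ.≟ suc (toℕ b)) →-dec (π a FP.<? π b) →-dec (π b FP.<? π c) →-dec no⊥

isMotzkin? : {n : ℕ} → (π : Fin n → Fin n) → Dec (IsMotzkin π)
isMotzkin? π = isPerm? π ×-dec avoids132? π ×-dec noAdj? π

fr : {n : ℕ} → (Fin n → Fin n) → ℕ
fr {n} π = length (filter (λ p → (proj₁ p FP.<? proj₂ p) ×-dec (π (proj₁ p) FP.<? π (proj₂ p)))
                          (cartesianProduct (allFin n) (allFin n)))

words : (m n : ℕ) → List (Vec (Fin n) m)
words zero n = [ [] ]
words (suc m) n = concatMap (λ v → map (λ x → x ∷ v) (allFin n)) (words m n)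

-- number of π ∈ 𝔐_n with fr(π) = k  (coefficient of x^n q^k of the LHS)
motzkinCount : ℕ → ℕ → ℕ
motzkinCount n k = length (filter (λ v → isMotzkin? (lookup v) ×-dec (fr (lookup v) ℕ.≟ k)) (words n n))

-- Formal power series in x, q with ℕ coefficients: f n k = [x^n q^k] f

Series : Set
Series = ℕ → ℕ → ℕ

sumTo : ℕ → (ℕ → ℕ) → ℕ
sumTo zero f = f zero
sumTo (suc n) f = sumTo n f + f (suc n)

mono : ℕ → ℕ → Series
mono a b n k with n ℕ.≟ a | k ℕ.≟ b
... | yes _ | yes _ = 1
... | _     | _     = 0

one : Series
one = mono 0 0

_⊕_ : Series → Series → Series
(f ⊕ g) n k = f n k + g n k

_⊗_ : Series → Series → Series
(f ⊗ g) n k = sumTo n λ i → sumTo k λ j → f i j * g (n ∸ i) (k ∸ j)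

pow : Series → ℕ → Series
pow h zero = one
pow h (suc m) = h ⊗ pow h m

-- 1/(1 - h) = Σ_m h^m, valid (and used only) for h with no x^0 terms,
-- in which case only m ≤ n contribute to the coefficient of x^n.
inv1- : Series → Series
inv1- h n k = sumTo n λ m → pow h m n k

-- Convergents of the continued fraction.  Level i has denominator
-- 1 - x q^i - x^2 q^(2i+1) · (level i+1); depth d truncates after d levels
-- (the tail is replaced by 0).
cf : (i d : ℕ) → Series
cf i zero = inv1- (mono 1 i)
cf i (suc d) = inv1- (mono 1 i ⊕ (mono 2 (2 * i + 1) ⊗ cf (suc i) d))

{-# OPTIONS --safe #-}
-- Let M(x, q) be the series of the theorem and M_i(x, q) = M(x q^i, q), so [x^n q^k] M_i counts
-- π ∈ 𝔐_n with i·n + fr(π) = k.  Cutting at the maximum, π ∈ 𝔐_(n+1) either starts with its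
-- maximum, followed by some π′ ∈ 𝔐_n, or is  α′ b n β  where β ∈ 𝔐_b uses the values below b and
-- α′ is some α ∈ 𝔐_a shifted above b (so a + b + 1 = n); then fr(π) = fr(π′), resp.
-- fr(α) + a + 1 + fr(β).  Hence  M_i = 1 + x q^i M_i + x² q^(2i+1) M_(i+1) M_i,  that is
-- M_i = 1 / (1 - x q^i - x² q^(2i+1) M_(i+1)).  The right-hand side needs only coefficients of
-- lower x-degree, so the depth-d convergent cf i d agrees with M_i in all x-degrees below d.
module Submission where

open import Defs
open import Data.Nat
  using (ℕ; zero; suc; _+_; _*_; _∸_; _≤_; _<_; _≟_; _≤?_; _<?_; z≤n; s≤s; z<s; s≤s⁻¹)
open import Data.Nat.Properties
open import Data.Nat.Tactic.RingSolver using (solve-∀)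
open import Algebra.Properties.CommutativeSemigroup +-commutativeSemigroup using (interchange)
open import Data.Fin as F using (Fin; zero; suc; toℕ)
import Data.Fin.Properties as FP
open import Function using (_∘_)
open import Data.Product using (_×_; _,_; proj₁; proj₂; ∃; ∃₂; ∃-syntax)
open import Data.Sum using (_⊎_; inj₁; inj₂)
open import Data.Empty using (⊥; ⊥-elim)
open import Data.Unit using (⊤; tt)
open import Relation.Binary.PropositionalEquality hiding ([_])
open import Relation.Nullary using (Dec; yes; no; ¬_)
open import Relation.Nullary.Decidable using (_×-dec_)
open import Relation.Unary using (Decidable)
open import Data.List
  using ( List; []; _∷_; [_]; _++_; _∷ʳ_; initLast; _∷ʳ′_; length; map; filter
        ; cartesianProduct; applyUpTo; tabulate; allFin)
open import Data.Nat.ListAction using (sum)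
open import Data.List.Properties
  using ( length-++; length-map; length-removeAt′; length-applyUpTo; length-tabulate
        ; ∷-injective; ∷ʳ-injective; ++-assoc; map-tabulate; tabulate-cong
        ; filter-accept; filter-reject; filter-none; filter-++)
open import Data.List.Relation.Unary.All as All using (All; []; _∷_)
import Data.List.Relation.Unary.All.Properties as Allₚ
open import Data.List.Relation.Unary.Any using (here; there; index; _─_)
open import Data.List.Relation.Unary.AllPairs as AllPairs using ([]; _∷_)
import Data.List.Relation.Unary.AllPairs.Properties as AllPairsₚ
open import Data.List.Relation.Unary.Unique.Propositional using (Unique)
import Data.List.Relation.Unary.Unique.Propositional.Properties as Uniqueₚ
open import Data.List.Relation.Binary.Disjoint.Propositional using (Disjoint)
open import Data.List.Membership.Propositional using (_∈_; _∉_)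
open import Data.List.Membership.Propositional.Properties
open import Data.List.Membership.DecPropositional _≟_ using (_∈?_)
open import Data.List.Relation.Binary.Subset.Propositional using (_⊆_)
open import Data.Vec as V using (Vec; []; _∷_)
import Data.Vec.Properties as Vecₚ

-- Finite sums

sumTo-cong : ∀ n {f g : ℕ → ℕ} → (∀ i → i ≤ n → f i ≡ g i) → sumTo n f ≡ sumTo n g
sumTo-cong zero    f≗g = f≗g 0 z≤n
sumTo-cong (suc n) f≗g =
  cong₂ _+_ (sumTo-cong n (λ i i≤n → f≗g i (m≤n⇒m≤1+n i≤n))) (f≗g (suc n) ≤-refl)

sumTo-zero : ∀ n {f : ℕ → ℕ} → (∀ i → i ≤ n → f i ≡ 0) → sumTo n f ≡ 0
sumTo-zero zero    f≗0 = f≗0 0 z≤n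
sumTo-zero (suc n) f≗0 =
  cong₂ _+_ (sumTo-zero n (λ i i≤n → f≗0 i (m≤n⇒m≤1+n i≤n))) (f≗0 (suc n) ≤-refl)

sumTo-+ : ∀ n (f g : ℕ → ℕ) → sumTo n (λ i → f i + g i) ≡ sumTo n f + sumTo n g
sumTo-+ zero    f g = refl
sumTo-+ (suc n) f g = trans (cong (_+ (f (suc n) + g (suc n))) (sumTo-+ n f g))
                            (interchange (sumTo n f) (sumTo n g) (f (suc n)) (g (suc n)))

sumTo-*ˡ : ∀ n c (f : ℕ → ℕ) → sumTo n (λ i → c * f i) ≡ c * sumTo n f
sumTo-*ˡ zero    c f = refl
sumTo-*ˡ (suc n) c f = trans (cong (_+ c * f (suc n)) (sumTo-*ˡ n c f))
                             (sym (*-distribˡ-+ c (sumTo n f) (f (suc n))))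

sumTo-swap : ∀ n m (f : ℕ → ℕ → ℕ) →
  sumTo n (λ i → sumTo m (f i)) ≡ sumTo m (λ j → sumTo n (λ i → f i j))
sumTo-swap zero    m f = refl
sumTo-swap (suc n) m f = trans (cong (_+ sumTo m (f (suc n))) (sumTo-swap n m f))
                               (sym (sumTo-+ m (λ j → sumTo n (λ i → f i j)) (f (suc n))))

sumTo-suc : ∀ n (f : ℕ → ℕ) → sumTo (suc n) f ≡ f 0 + sumTo n (λ i → f (suc i))
sumTo-suc zero    f = refl
sumTo-suc (suc n) f = trans (cong (_+ f (suc (suc n))) (sumTo-suc n f)) (+-assoc (f 0) _ _)

sumTo-dropInit : ∀ a n (f : ℕ → ℕ) → a ≤ n → (∀ i → i < a → f i ≡ 0) →
  sumTo n f ≡ sumTo (n ∸ a) (λ i → f (a + i))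
sumTo-dropInit zero    n       f _         _   = refl
sumTo-dropInit (suc a) (suc n) f (s≤s a≤n) f≗0 = begin
  sumTo (suc n) f                       ≡⟨ sumTo-suc n f ⟩
  f 0 + sumTo n f∘suc                   ≡⟨ cong (_+ sumTo n f∘suc) (f≗0 0 z<s) ⟩
  sumTo n f∘suc                         ≡⟨ sumTo-dropInit a n f∘suc a≤n (λ i i<a → f≗0 (suc i) (s≤s i<a)) ⟩
  sumTo (n ∸ a) (λ i → f (suc (a + i))) ∎
  where
  open ≡-Reasoning
  f∘suc = λ i → f (suc i)

sumTo-dropTail : ∀ m n (f : ℕ → ℕ) → m ≤ n → (∀ i → m < i → i ≤ n → f i ≡ 0) →
  sumTo n f ≡ sumTo m f
sumTo-dropTail m zero    f z≤n _   = refl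
sumTo-dropTail m (suc n) f m≤1+n f≗0 with m≤n⇒m<n∨m≡n m≤1+n
... | inj₂ refl      = refl
... | inj₁ (s≤s m≤n) = trans
  (cong₂ _+_ (sumTo-dropTail m n f m≤n (λ i m<i i≤n → f≗0 i m<i (m≤n⇒m≤1+n i≤n))) (f≗0 (suc n) (s≤s m≤n) ≤-refl))
  (+-identityʳ _)

sumTo-single : ∀ a n (f : ℕ → ℕ) → a ≤ n → (∀ i → i ≤ n → i ≢ a → f i ≡ 0) → sumTo n f ≡ f a
sumTo-single a zero    f z≤n   _   = refl
sumTo-single a (suc n) f a≤1+n f≗0 with m≤n⇒m<n∨m≡n a≤1+n
... | inj₂ refl      =
  cong (_+ f (suc n)) (sumTo-zero n (λ i i≤n → f≗0 i (m≤n⇒m≤1+n i≤n) (<⇒≢ (s≤s i≤n))))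
... | inj₁ (s≤s a≤n) = trans
  (cong₂ _+_ (sumTo-single a n f a≤n (λ i i≤n → f≗0 i (m≤n⇒m≤1+n i≤n))) (f≗0 (suc n) ≤-refl (≢-sym (<⇒≢ (s≤s a≤n)))))
  (+-identityʳ (f a))

-- Power series in x and q, and the continued fraction

shift : ℕ → ℕ → Series → Series
shift a b g n k with a ≤? n | b ≤? k
... | yes _ | yes _ = g (n ∸ a) (k ∸ b)
... | _     | _     = 0

shift-≤ : ∀ a b g {n k} → a ≤ n → b ≤ k → shift a b g n k ≡ g (n ∸ a) (k ∸ b)
shift-≤ a b g {n} {k} a≤n b≤k with a ≤? n | b ≤? k
... | yes _  | yes _  = refl
... | no a≰n | _      = ⊥-elim (a≰n a≤n)
... | yes _  | no b≰k = ⊥-elim (b≰k b≤k)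

shift-< : ∀ a b g n k → n < a ⊎ k < b → shift a b g n k ≡ 0
shift-< a b g n k n<a⊎k<b with a ≤? n | b ≤? k | n<a⊎k<b
... | yes a≤n | yes _   | inj₁ n<a = ⊥-elim (<⇒≱ n<a a≤n)
... | yes _   | yes b≤k | inj₂ k<b = ⊥-elim (<⇒≱ k<b b≤k)
... | yes _   | no _    | _        = refl
... | no _    | _       | _        = refl

shift-+ : ∀ a b g i j → shift a b g (a + i) (b + j) ≡ g i j
shift-+ a b g i j =
  trans (shift-≤ a b g (m≤m+n a i) (m≤m+n b j)) (cong₂ g (m+n∸m≡n a i) (m+n∸m≡n b j))

shift-by-cases : ∀ a b g {n k x} → a ≤ n → (b ≤ k → x ≡ g (n ∸ a) (k ∸ b)) → (k < b → x ≡ 0) →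
  x ≡ shift a b g n k
shift-by-cases a b g {n} {k} {x} a≤n x≡g x≡0 = by-cases (b ≤? k)
  where
  by-cases : Dec (b ≤ k) → x ≡ shift a b g n k
  by-cases (yes b≤k) = trans (x≡g b≤k) (sym (shift-≤ a b g a≤n b≤k))
  by-cases (no b≰k)  = trans (x≡0 (≰⇒> b≰k)) (sym (shift-< a b g n k (inj₂ (≰⇒> b≰k))))

mono-≡ : ∀ a b → mono a b a b ≡ 1
mono-≡ a b with a ≟ a | b ≟ b
... | yes _  | yes _  = refl
... | no a≢a | _      = ⊥-elim (a≢a refl)
... | yes _  | no b≢b = ⊥-elim (b≢b refl)

mono-≢ : ∀ a b i j → i ≢ a ⊎ j ≢ b → mono a b i j ≡ 0
mono-≢ a b i j i≢a⊎j≢b with i ≟ a | j ≟ b | i≢a⊎j≢b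
... | yes i≡a | yes _   | inj₁ i≢a = ⊥-elim (i≢a i≡a)
... | yes _   | yes j≡b | inj₂ j≢b = ⊥-elim (j≢b j≡b)
... | yes _   | no _    | _        = refl
... | no _    | _       | _        = refl

⊗-distribʳ-⊕ : ∀ f g h n k → ((f ⊕ g) ⊗ h) n k ≡ (f ⊗ h) n k + (g ⊗ h) n k
⊗-distribʳ-⊕ f g h n k = trans
  (sumTo-cong n λ i _ → trans (sumTo-cong k λ j _ → *-distribʳ-+ (h (n ∸ i) (k ∸ j)) (f i j) (g i j))
                              (sumTo-+ k _ _))
  (sumTo-+ n _ _)

⊗-congˡ : ∀ {f f′} g n k → (∀ i j → f i j ≡ f′ i j) → (f ⊗ g) n k ≡ (f′ ⊗ g) n k
⊗-congˡ g n k f≗f′ = sumTo-cong n λ i _ → sumTo-cong k λ j _ → cong (_* _) (f≗f′ i j)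

mono-⊗ : ∀ a b g n k → (mono a b ⊗ g) n k ≡ shift a b g n k
mono-⊗ a b g n k with a ≤? n | b ≤? k
... | yes a≤n | yes b≤k = begin
  sumTo n (λ i → sumTo k (λ j → mono a b i j * g (n ∸ i) (k ∸ j)))
    ≡⟨ sumTo-single a n (λ i → sumTo k (λ j → mono a b i j * g (n ∸ i) (k ∸ j))) a≤n
         (λ i _ i≢a → sumTo-zero k λ j _ → cong (_* g (n ∸ i) (k ∸ j)) (mono-≢ a b i j (inj₁ i≢a))) ⟩
  sumTo k (λ j → mono a b a j * g (n ∸ a) (k ∸ j))
    ≡⟨ sumTo-single b k (λ j → mono a b a j * g (n ∸ a) (k ∸ j)) b≤k
         (λ j _ j≢b → cong (_* g (n ∸ a) (k ∸ j)) (mono-≢ a b a j (inj₂ j≢b))) ⟩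
  mono a b a b * g (n ∸ a) (k ∸ b)
    ≡⟨ cong (_* g (n ∸ a) (k ∸ b)) (mono-≡ a b) ⟩
  1 * g (n ∸ a) (k ∸ b)
    ≡⟨ *-identityˡ _ ⟩
  g (n ∸ a) (k ∸ b) ∎
  where open ≡-Reasoning
... | no a≰n | _ = sumTo-zero n λ i i≤n → sumTo-zero k λ j _ →
  cong (_* g (n ∸ i) (k ∸ j)) (mono-≢ a b i j (inj₁ λ { refl → a≰n i≤n }))
... | yes _ | no b≰k = sumTo-zero n λ i _ → sumTo-zero k λ j j≤k →
  cong (_* g (n ∸ i) (k ∸ j)) (mono-≢ a b i j (inj₂ λ { refl → b≰k j≤k }))

shift-⊗ : ∀ a b f g n k → (shift a b f ⊗ g) n k ≡ shift a b (f ⊗ g) n k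
shift-⊗ a b f g n k with a ≤? n | b ≤? k
... | yes a≤n | yes b≤k = begin
  sumTo n (λ i → sumTo k (λ j → shift a b f i j * g (n ∸ i) (k ∸ j)))
    ≡⟨ sumTo-dropInit a n _ a≤n (λ i i<a → sumTo-zero k λ j _ →
         cong (_* g (n ∸ i) (k ∸ j)) (shift-< a b f i j (inj₁ i<a))) ⟩
  sumTo (n ∸ a) (λ i → sumTo k (λ j → shift a b f (a + i) j * g (n ∸ (a + i)) (k ∸ j)))
    ≡⟨ sumTo-cong (n ∸ a) (λ i _ → sumTo-dropInit b k _ b≤k λ j j<b →
         cong (_* g (n ∸ (a + i)) (k ∸ j)) (shift-< a b f (a + i) j (inj₂ j<b))) ⟩
  sumTo (n ∸ a) (λ i → sumTo (k ∸ b) (λ j →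
    shift a b f (a + i) (b + j) * g (n ∸ (a + i)) (k ∸ (b + j))))
    ≡⟨ sumTo-cong (n ∸ a) (λ i _ → sumTo-cong (k ∸ b) λ j _ →
         cong₂ _*_ (shift-+ a b f i j) (cong₂ g (sym (∸-+-assoc n a i)) (sym (∸-+-assoc k b j)))) ⟩
  sumTo (n ∸ a) (λ i → sumTo (k ∸ b) (λ j → f i j * g (n ∸ a ∸ i) (k ∸ b ∸ j))) ∎
  where open ≡-Reasoning
... | no a≰n | _ = sumTo-zero n λ i i≤n → sumTo-zero k λ j _ →
  cong (_* g (n ∸ i) (k ∸ j)) (shift-< a b f i j (inj₁ (≤-<-trans i≤n (≰⇒> a≰n))))
... | yes _ | no b≰k = sumTo-zero n λ i _ → sumTo-zero k λ j j≤k →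
  cong (_* g (n ∸ i) (k ∸ j)) (shift-< a b f i j (inj₂ (≤-<-trans j≤k (≰⇒> b≰k))))

module _ {h : Series} (h₀ : ∀ k → h 0 k ≡ 0) where

  pow-vanishes : ∀ m n k → n < m → pow h m n k ≡ 0
  pow-vanishes (suc m) n k (s≤s n≤m) = sumTo-zero n λ i i≤n → sumTo-zero k λ j _ → term i i≤n j
    where
    term : ∀ i → i ≤ n → ∀ j → h i j * pow h m (n ∸ i) (k ∸ j) ≡ 0
    term zero    _   j = cong (_* pow h m n (k ∸ j)) (h₀ j)
    term (suc i) i<n j = trans (cong (h (suc i) j *_) (pow-vanishes m (n ∸ suc i) (k ∸ j) n∸1+i<m))
                               (*-zeroʳ (h (suc i) j))
      where n∸1+i<m = <-≤-trans (∸-monoʳ-< z<s i<n) n≤m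

  sumTo-⊗ : ∀ M (P : ℕ → Series) n k →
    sumTo M (λ m → (h ⊗ P m) n k) ≡ (h ⊗ (λ a b → sumTo M (λ m → P m a b))) n k
  sumTo-⊗ M P n k = trans (sumTo-swap M n _) (sumTo-cong n λ i _ → trans (sumTo-swap M k _)
    (sumTo-cong k λ j _ → sumTo-*ˡ M (h i j) (λ m → P m (n ∸ i) (k ∸ j))))

  inv1--unfold : ∀ n k → inv1- h n k ≡ (one ⊕ (h ⊗ inv1- h)) n k
  inv1--unfold zero k = sym (trans
    (cong (one 0 k +_) (sumTo-zero k λ j _ → cong (_* inv1- h 0 (k ∸ j)) (h₀ j)))
    (+-identityʳ (one 0 k)))
  inv1--unfold (suc M) k = begin
    sumTo (suc M) (λ m → pow h m (suc M) k)
      ≡⟨ sumTo-suc M (λ m → pow h m (suc M) k) ⟩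
    one (suc M) k + sumTo M (λ m → (h ⊗ pow h m) (suc M) k)
      ≡⟨ cong (one (suc M) k +_) (sumTo-⊗ M (pow h) (suc M) k) ⟩
    one (suc M) k + (h ⊗ (λ a b → sumTo M (λ m → pow h m a b))) (suc M) k
      ≡⟨ cong (one (suc M) k +_) (sumTo-cong (suc M) λ i i≤ → sumTo-cong k λ j _ → term i i≤ j) ⟩
    one (suc M) k + (h ⊗ inv1- h) (suc M) k ∎
    where
    open ≡-Reasoning
    term : ∀ i → i ≤ suc M → ∀ j →
      h i j * sumTo M (λ m → pow h m (suc M ∸ i) (k ∸ j)) ≡ h i j * inv1- h (suc M ∸ i) (k ∸ j)
    term zero    _         j = trans (cong (_* sumTo M (λ m → pow h m (suc M) (k ∸ j))) (h₀ j))
                                     (sym (cong (_* inv1- h (suc M) (k ∸ j)) (h₀ j)))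
    term (suc i) (s≤s i≤M) j = cong (h (suc i) j *_)
      (sumTo-dropTail (M ∸ i) M _ (m∸n≤m M i) λ m M∸i<m _ → pow-vanishes m (M ∸ i) (k ∸ j) M∸i<m)

cfStep : ℕ → Series → Series → Series
cfStep i A B = one ⊕ (shift 1 i A ⊕ shift 2 (2 * i + 1) (B ⊗ A))

cf-unfold : ∀ i d n k → cf i (suc d) n k ≡ cfStep i (cf i (suc d)) (cf (suc i) d) n k
cf-unfold i d n k = begin
  cf i (suc d) n k
    ≡⟨ inv1--unfold h₀ n k ⟩
  one n k + ((mono 1 i ⊕ (mono 2 (2 * i + 1) ⊗ B)) ⊗ A) n k
    ≡⟨ cong (one n k +_) (⊗-distribʳ-⊕ (mono 1 i) (mono 2 (2 * i + 1) ⊗ B) A n k) ⟩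
  one n k + ((mono 1 i ⊗ A) n k + ((mono 2 (2 * i + 1) ⊗ B) ⊗ A) n k)
    ≡⟨ cong (one n k +_) (cong₂ _+_ (mono-⊗ 1 i A n k) mono²-⊗) ⟩
  cfStep i A B n k ∎
  where
  open ≡-Reasoning
  A = cf i (suc d)
  B = cf (suc i) d
  h₀ : ∀ k → (mono 1 i ⊕ (mono 2 (2 * i + 1) ⊗ B)) 0 k ≡ 0
  h₀ k = cong₂ _+_ (mono-≢ 1 i 0 k (inj₁ λ ()))
                   (trans (mono-⊗ 2 (2 * i + 1) B 0 k) (shift-< 2 (2 * i + 1) B 0 k (inj₁ z<s)))
  mono²-⊗ : ((mono 2 (2 * i + 1) ⊗ B) ⊗ A) n k ≡ shift 2 (2 * i + 1) (B ⊗ A) n k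
  mono²-⊗ = trans (⊗-congˡ A n k (mono-⊗ 2 (2 * i + 1) B)) (shift-⊗ 2 (2 * i + 1) B A n k)

infix 4 _≈[_]_
_≈[_]_ : Series → ℕ → Series → Set
f ≈[ n ] g = ∀ {m} → m < n → ∀ k → f m k ≡ g m k

≈-weaken : ∀ {f g m n} → m ≤ n → f ≈[ n ] g → f ≈[ m ] g
≈-weaken m≤n f≈g m′<m = f≈g (<-≤-trans m′<m m≤n)

⊗-≈ : ∀ {f f′ g g′ n} → f ≈[ n ] f′ → g ≈[ n ] g′ → (f ⊗ g) ≈[ n ] (f′ ⊗ g′)
⊗-≈ f≈f′ g≈g′ {m} m<n k = sumTo-cong m λ i i≤m → sumTo-cong k λ j _ →
  cong₂ _*_ (f≈f′ (≤-<-trans i≤m m<n) j) (g≈g′ (≤-<-trans (m∸n≤m m i) m<n) (k ∸ j))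

shift-≈ : ∀ a b {f g n} → f ≈[ n ] g → shift a b f ≈[ a + n ] shift a b g
shift-≈ a b {f} {g} {n} f≈g {m} m<a+n k with a ≤? m | b ≤? k
... | yes a≤m | yes _ = f≈g (subst (m ∸ a <_) (m+n∸m≡n a n) (∸-monoˡ-< m<a+n a≤m)) (k ∸ b)
... | yes _   | no _  = refl
... | no _    | _     = refl

cfStep-≈ : ∀ i {A A′ B B′ n} → A ≈[ n ] A′ → B ≈[ n ] B′ → cfStep i A B ≈[ suc n ] cfStep i A′ B′
cfStep-≈ i A≈A′ B≈B′ {m} m<1+n k = cong (one m k +_) (cong₂ _+_
  (shift-≈ 1 i A≈A′ m<1+n k)
  (≈-weaken (n≤1+n _) (shift-≈ 2 (2 * i + 1) (⊗-≈ B≈B′ A≈A′)) m<1+n k))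

module _ (T : ℕ → Series) (T-step : ∀ i n k → T i n k ≡ cfStep i (T i) (T (suc i)) n k) where

  cf-approximates : ∀ n i d → n ≤ d → cf i d ≈[ n ] T i
  cf-approximates zero    i d       _         ()
  cf-approximates (suc n) i (suc d) (s≤s n≤d) {m} m<1+n k = begin
    cf i (suc d) m k
      ≡⟨ cf-unfold i d m k ⟩
    cfStep i (cf i (suc d)) (cf (suc i) d) m k
      ≡⟨ cfStep-≈ i (cf-approximates n i (suc d) (m≤n⇒m≤1+n n≤d)) (cf-approximates n (suc i) d n≤d) m<1+n k ⟩
    cfStep i (T i) (T (suc i)) m k
      ≡⟨ T-step i m k ⟨
    T i m k ∎
    where open ≡-Reasoning

-- Counting in lists

module _ {A : Set} where

  length-filter-cong : ∀ {P Q : A → Set} (P? : Decidable P) (Q? : Decidable Q) xs →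
    (∀ x → x ∈ xs → (P x → Q x) × (Q x → P x)) → length (filter P? xs) ≡ length (filter Q? xs)
  length-filter-cong P? Q? []       _   = refl
  length-filter-cong P? Q? (x ∷ xs) P⇔Q with P? x | Q? x
  ... | yes _  | yes _  = cong suc (length-filter-cong P? Q? xs λ y y∈ → P⇔Q y (there y∈))
  ... | no _   | no _   = length-filter-cong P? Q? xs λ y y∈ → P⇔Q y (there y∈)
  ... | yes px | no ¬qx = ⊥-elim (¬qx (proj₁ (P⇔Q x (here refl)) px))
  ... | no ¬px | yes qx = ⊥-elim (¬px (proj₂ (P⇔Q x (here refl)) qx))

  length-filter-++ : ∀ {P : A → Set} (P? : Decidable P) xs ys →
    length (filter P? (xs ++ ys)) ≡ length (filter P? xs) + length (filter P? ys)
  length-filter-++ P? xs ys = trans (cong length (filter-++ P? xs ys)) (length-++ (filter P? xs))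

  length-filter-map : ∀ {B : Set} {P : B → Set} (P? : Decidable P) (f : A → B) xs →
    length (filter P? (map f xs)) ≡ length (filter (λ x → P? (f x)) xs)
  length-filter-map P? f []       = refl
  length-filter-map P? f (x ∷ xs) with P? (f x)
  ... | yes _ = cong suc (length-filter-map P? f xs)
  ... | no _  = length-filter-map P? f xs

  ∈-─ : ∀ {x z : A} {ys} (x∈ys : x ∈ ys) → z ∈ ys → z ≢ x → z ∈ (ys ─ x∈ys)
  ∈-─ (here refl) (here refl) z≢x = ⊥-elim (z≢x refl)
  ∈-─ (here _)    (there z∈)  _   = z∈
  ∈-─ (there _)   (here refl) _   = here refl
  ∈-─ (there x∈)  (there z∈)  z≢x = there (∈-─ x∈ z∈ z≢x)

  Unique-⊆⇒length≤ : ∀ {xs ys : List A} → Unique xs → xs ⊆ ys → length xs ≤ length ys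
  Unique-⊆⇒length≤ {[]}             _              _     = z≤n
  Unique-⊆⇒length≤ {x ∷ xs} {ys} (x∉xs ∷ xs!) xs⊆ys =
    subst (suc (length xs) ≤_) (sym (length-removeAt′ ys (index x∈ys)))
          (s≤s (Unique-⊆⇒length≤ xs! xs⊆ys─x))
    where
    x∈ys = xs⊆ys (here refl)
    xs⊆ys─x : xs ⊆ (ys ─ x∈ys)
    xs⊆ys─x z∈ = ∈-─ x∈ys (xs⊆ys (there z∈)) λ { refl → All.lookup x∉xs z∈ refl }

  Unique-map⁺-∈ : ∀ {B : Set} {f : A → B} {xs} → Unique xs →
    (∀ {x y} → x ∈ xs → y ∈ xs → f x ≡ f y → x ≡ y) → Unique (map f xs)
  Unique-map⁺-∈ {xs = []}     []          _     = []
  Unique-map⁺-∈ {xs = x ∷ xs} (x∉ ∷ xs!) f-inj =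
    Allₚ.map⁺ (All.tabulate (λ y∈ fx≡fy → All.lookup x∉ y∈ (f-inj (here refl) (there y∈) fx≡fy))) ∷
    Unique-map⁺-∈ xs! (λ x∈ y∈ → f-inj (there x∈) (there y∈))

  length-filter-reindex : ∀ {C : Set} {Q : C → Set} (Q? : Decidable Q) (c : C → A) xs ys →
    Unique xs → Unique ys → (∀ {x y} → c x ≡ c y → x ≡ y) →
    (∀ x → x ∈ xs → Q x → c x ∈ ys) → (∀ y → y ∈ ys → ∃ λ x → x ∈ xs × Q x × c x ≡ y) →
    ∀ {P : A → Set} (P? : Decidable P) →
    length (filter (λ x → Q? x ×-dec P? (c x)) xs) ≡ length (filter P? ys)
  length-filter-reindex Q? c xs ys xs! ys! c-inj into onto P? = trans (sym (length-map c selected))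
    (≤-antisym (Unique-⊆⇒length≤ (Uniqueₚ.map⁺ c-inj (Uniqueₚ.filter⁺ R? xs!)) image⊆)
               (Unique-⊆⇒length≤ (Uniqueₚ.filter⁺ P? ys!) ⊆image))
    where
    R? = λ x → Q? x ×-dec P? (c x)
    selected = filter R? xs
    image⊆ : map c selected ⊆ filter P? ys
    image⊆ z∈ with x , x∈ , refl ← ∈-map⁻ c z∈
              with x∈xs , (qx , px) ← ∈-filter⁻ R? {xs = xs} x∈ = ∈-filter⁺ P? (into x x∈xs qx) px
    ⊆image : filter P? ys ⊆ map c selected
    ⊆image {z} z∈ with z∈ys , pz ← ∈-filter⁻ P? {xs = ys} z∈
                  with x , x∈xs , qx , refl ← onto z z∈ys = ∈-map⁺ c (∈-filter⁺ R? x∈xs (qx , pz))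

length-filter-cartesianProduct : ∀ {A B : Set} {P : A × B → Set} (P? : Decidable P) xs ys →
  length (filter P? (cartesianProduct xs ys)) ≡ sum (map (λ x → length (filter (λ y → P? (x , y)) ys)) xs)
length-filter-cartesianProduct P? []       ys = refl
length-filter-cartesianProduct P? (x ∷ xs) ys =
  trans (length-filter-++ P? (map (x ,_) ys) (cartesianProduct xs ys))
        (cong₂ _+_ (length-filter-map P? (x ,_) ys) (length-filter-cartesianProduct P? xs ys))

length-filter-tabulate : ∀ {A : Set} {n} {P : A → Set} (P? : Decidable P) (f : Fin n → A) →
  length (filter P? (tabulate f)) ≡ length (filter (P? ∘ f) (allFin n))
length-filter-tabulate P? f = trans (cong (length ∘ filter P?) (sym (map-tabulate (λ i → i) f)))
                                    (length-filter-map P? f (allFin _))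

Unique-tabulate⁻ : ∀ {A : Set} {n} {f : Fin n → A} → Unique (tabulate f) →
  ∀ i j → f i ≡ f j → i ≡ j
Unique-tabulate⁻ (f₀∉ ∷ _)  zero    zero    _  = refl
Unique-tabulate⁻ (f₀∉ ∷ _)  zero    (suc j) eq = ⊥-elim (Allₚ.tabulate⁻ f₀∉ j eq)
Unique-tabulate⁻ (f₀∉ ∷ _)  (suc i) zero    eq = ⊥-elim (Allₚ.tabulate⁻ f₀∉ i (sym eq))
Unique-tabulate⁻ (_ ∷ f!)   (suc i) (suc j) eq = cong suc (Unique-tabulate⁻ f! i j eq)

countOfWeight : ∀ {A : Set} → (A → ℕ) → List A → ℕ → ℕ
countOfWeight w xs k = length (filter (λ x → w x ≟ k) xs)

module _ {A : Set} where

  countOfWeight-cong : ∀ {w w′ : A → ℕ} xs k → (∀ {x} → x ∈ xs → w x ≡ w′ x) →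
    countOfWeight w xs k ≡ countOfWeight w′ xs k
  countOfWeight-cong xs k w≗w′ = length-filter-cong _ _ xs λ _ x∈ → trans (sym (w≗w′ x∈)) , trans (w≗w′ x∈)

  countOfWeight-+ : ∀ (w : A → ℕ) xs c k → c ≤ k → countOfWeight (λ x → w x + c) xs k ≡ countOfWeight w xs (k ∸ c)
  countOfWeight-+ w xs c k c≤k = length-filter-cong _ _ xs λ x _ →
    (λ eq → trans (sym (m+n∸n≡m (w x) c)) (cong (_∸ c) eq)) , (λ eq → trans (cong (_+ c) eq) (m∸n+n≡m c≤k))

  countOfWeight-+-< : ∀ (w : A → ℕ) xs c k → k < c → countOfWeight (λ x → w x + c) xs k ≡ 0
  countOfWeight-+-< w xs c k k<c =
    cong length (filter-none _ (All.universal (λ x eq → <⇒≱ k<c (subst (c ≤_) eq (m≤n+m c (w x)))) xs))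

  countOfWeight-[-]-≡ : ∀ (w : A → ℕ) x → countOfWeight w [ x ] (w x) ≡ 1
  countOfWeight-[-]-≡ w x = cong length (filter-accept (λ y → w y ≟ w x) {xs = []} refl)

  countOfWeight-[-]-≢ : ∀ (w : A → ℕ) x {j} → w x ≢ j → countOfWeight w [ x ] j ≡ 0
  countOfWeight-[-]-≢ w x {j} wx≢j = cong length (filter-reject (λ y → w y ≟ j) {xs = []} wx≢j)

countOfWeight-row : ∀ {A B : Set} (g : A → ℕ) (h : B → ℕ) x ys K →
  countOfWeight (λ y → g x + h y) ys K ≡ sumTo K (λ j → countOfWeight g [ x ] j * countOfWeight h ys (K ∸ j))
countOfWeight-row g h x ys K with g x ≤? K
... | yes gx≤K = begin
  countOfWeight (λ y → g x + h y) ys K ≡⟨ countOfWeight-cong ys K (λ {y} _ → +-comm (g x) (h y)) ⟩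
  countOfWeight (λ y → h y + g x) ys K ≡⟨ countOfWeight-+ h ys (g x) K gx≤K ⟩
  countOfWeight h ys (K ∸ g x)         ≡⟨ trans (cong (_* countOfWeight h ys (K ∸ g x)) (countOfWeight-[-]-≡ g x))
                                                  (*-identityˡ _) ⟨
  countOfWeight g [ x ] (g x) * countOfWeight h ys (K ∸ g x)
    ≡⟨ sumTo-single (g x) K (λ j → countOfWeight g [ x ] j * countOfWeight h ys (K ∸ j)) gx≤K
         (λ j _ j≢gx → cong (_* countOfWeight h ys (K ∸ j)) (countOfWeight-[-]-≢ g x (≢-sym j≢gx))) ⟨
  sumTo K (λ j → countOfWeight g [ x ] j * countOfWeight h ys (K ∸ j)) ∎
  where open ≡-Reasoning
... | no gx≰K = trans
  (countOfWeight-cong ys K (λ {y} _ → +-comm (g x) (h y)))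
  (trans (countOfWeight-+-< h ys (g x) K (≰⇒> gx≰K))
         (sym (sumTo-zero K λ j j≤K → cong (_* countOfWeight h ys (K ∸ j))
                (countOfWeight-[-]-≢ g x λ { refl → gx≰K j≤K }))))

countOfWeight-cartesianProduct : ∀ {A B : Set} (g : A → ℕ) (h : B → ℕ) xs ys K →
  countOfWeight (λ p → g (proj₁ p) + h (proj₂ p)) (cartesianProduct xs ys) K ≡
  sumTo K (λ j → countOfWeight g xs j * countOfWeight h ys (K ∸ j))
countOfWeight-cartesianProduct g h []       ys K = sym (sumTo-zero K λ _ _ → refl)
countOfWeight-cartesianProduct g h (x ∷ xs) ys K = begin
  countOfWeight w (map (x ,_) ys ++ cartesianProduct xs ys) K
    ≡⟨ length-filter-++ (λ p → w p ≟ K) (map (x ,_) ys) (cartesianProduct xs ys) ⟩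
  countOfWeight w (map (x ,_) ys) K + countOfWeight w (cartesianProduct xs ys) K
    ≡⟨ cong₂ _+_ (trans (length-filter-map (λ p → w p ≟ K) (x ,_) ys) (countOfWeight-row g h x ys K))
                 (countOfWeight-cartesianProduct g h xs ys K) ⟩
  sumTo K (λ j → countOfWeight g [ x ] j * H j) + sumTo K (λ j → countOfWeight g xs j * H j)
    ≡⟨ sumTo-+ K (λ j → countOfWeight g [ x ] j * H j) (λ j → countOfWeight g xs j * H j) ⟨
  sumTo K (λ j → countOfWeight g [ x ] j * H j + countOfWeight g xs j * H j)
    ≡⟨ sumTo-cong K (λ j _ → trans (sym (*-distribʳ-+ (H j) (countOfWeight g [ x ] j) (countOfWeight g xs j)))
                                   (cong (_* H j) (sym (length-filter-++ (λ y → g y ≟ j) [ x ] xs)))) ⟩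
  sumTo K (λ j → countOfWeight g (x ∷ xs) j * H j) ∎
  where
  open ≡-Reasoning
  w = λ p → g (proj₁ p) + h (proj₂ p)
  H = λ j → countOfWeight h ys (K ∸ j)

-- Motzkin permutations as lists of values

Avoids132From : ℕ → List ℕ → Set
Avoids132From x []       = ⊤
Avoids132From x (y ∷ ys) = All (λ z → ¬ (x < z × z < y)) ys × Avoids132From x ys

Avoids132List : List ℕ → Set
Avoids132List []       = ⊤
Avoids132List (x ∷ xs) = Avoids132From x xs × Avoids132List xs

NoAdjFrom : ℕ → List ℕ → Set
NoAdjFrom x []           = ⊤
NoAdjFrom x (y ∷ [])     = ⊤
NoAdjFrom x (y ∷ z ∷ zs) = ¬ (x < y × y < z) × NoAdjFrom x (z ∷ zs)

NoAdjList : List ℕ → Set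
NoAdjList []       = ⊤
NoAdjList (x ∷ xs) = NoAdjFrom x xs × NoAdjList xs

IsMotzkinList : ℕ → List ℕ → Set
IsMotzkinList n l = length l ≡ n × All (_< n) l × Unique l × Avoids132List l × NoAdjList l

countAbove : ℕ → List ℕ → ℕ
countAbove x ys = length (filter (x <?_) ys)

frList : List ℕ → ℕ
frList []       = 0
frList (x ∷ xs) = countAbove x xs + frList xs

Avoids132From-∷-below : ∀ {x} y ys → All (_≤ x) ys → Avoids132From x (y ∷ ys)
Avoids132From-below : ∀ {x} ys → All (_≤ x) ys → Avoids132From x ys

Avoids132From-∷-below y ys ys≤x =
  All.map (λ z≤x (x<z , _) → <⇒≱ x<z z≤x) ys≤x , Avoids132From-below ys ys≤x

Avoids132From-below []       _           = tt
Avoids132From-below (y ∷ ys) (_ ∷ ys≤x) = Avoids132From-∷-below y ys ys≤x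

NoAdjFrom-∷-below : ∀ {x} y ys → All (_≤ x) ys → NoAdjFrom x (y ∷ ys)
NoAdjFrom-∷-below y []       _              = tt
NoAdjFrom-∷-below y (z ∷ zs) (z≤x ∷ zs≤x) =
  (λ (x<y , y<z) → <⇒≱ (<-trans x<y y<z) z≤x) , NoAdjFrom-∷-below z zs zs≤x

NoAdjFrom-below : ∀ {x} ys → All (_≤ x) ys → NoAdjFrom x ys
NoAdjFrom-below []       _           = tt
NoAdjFrom-below (y ∷ ys) (_ ∷ ys≤x) = NoAdjFrom-∷-below y ys ys≤x

Avoids132From-++ : ∀ {x} X Y → Avoids132From x X → Avoids132From x Y →
  (∀ {y z} → y ∈ X → z ∈ Y → ¬ (x < z × z < y)) → Avoids132From x (X ++ Y)
Avoids132From-++ []      Y _            avY _     = avY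
Avoids132From-++ (y ∷ X) Y (avy , avX) avY cross =
  Allₚ.++⁺ avy (All.tabulate (cross (here refl))) , Avoids132From-++ X Y avX avY (cross ∘ there)

Avoids132List-++ : ∀ X Y → Avoids132List X → Avoids132List Y →
  (∀ {x} → x ∈ X → Avoids132From x Y) → (∀ {x y z} → x ∈ X → y ∈ X → z ∈ Y → ¬ (x < z × z < y)) →
  Avoids132List (X ++ Y)
Avoids132List-++ []      Y _            avY _     _     = avY
Avoids132List-++ (x ∷ X) Y (avx , avX) avY avXY cross =
  Avoids132From-++ X Y avx (avXY (here refl)) (λ y∈ z∈ → cross (here refl) (there y∈) z∈) ,
  Avoids132List-++ X Y avX avY (avXY ∘ there) (λ x∈ y∈ → cross (there x∈) (there y∈))

NoAdjFrom-++ : ∀ {x} X y Y → NoAdjFrom x X → (∀ {w} → w ∈ X → ¬ (x < w × w < y)) →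
  NoAdjFrom x (y ∷ Y) → NoAdjFrom x (X ++ y ∷ Y)
NoAdjFrom-++ []          y Y _           _     naY = naY
NoAdjFrom-++ (p ∷ [])    y Y _           cross naY = cross (here refl) , naY
NoAdjFrom-++ (p ∷ q ∷ X) y Y (¬pq , naX) cross naY = ¬pq , NoAdjFrom-++ (q ∷ X) y Y naX (cross ∘ there) naY

NoAdjList-++ : ∀ X y Y → NoAdjList X → NoAdjList (y ∷ Y) →
  (∀ {x} → x ∈ X → NoAdjFrom x (y ∷ Y)) → (∀ {x w} → x ∈ X → w ∈ X → ¬ (x < w × w < y)) →
  NoAdjList (X ++ y ∷ Y)
NoAdjList-++ []      y Y _            naY _      _     = naY
NoAdjList-++ (x ∷ X) y Y (nax , naX) naY naXY cross =
  NoAdjFrom-++ X y Y nax (λ w∈ → cross (here refl) (there w∈)) (naXY (here refl)) ,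
  NoAdjList-++ X y Y naX naY (λ x∈ → naXY (there x∈)) (λ x∈ w∈ → cross (there x∈) (there w∈))

Avoids132From-++⁻ˡ : ∀ {x} X Y → Avoids132From x (X ++ Y) → Avoids132From x X
Avoids132From-++⁻ˡ []      Y _           = tt
Avoids132From-++⁻ˡ (y ∷ X) Y (avy , av) = Allₚ.++⁻ˡ X avy , Avoids132From-++⁻ˡ X Y av

Avoids132List-++⁻ˡ : ∀ X Y → Avoids132List (X ++ Y) → Avoids132List X
Avoids132List-++⁻ˡ []      Y _           = tt
Avoids132List-++⁻ˡ (x ∷ X) Y (avx , av) = Avoids132From-++⁻ˡ X Y avx , Avoids132List-++⁻ˡ X Y av

Avoids132List-++⁻ʳ : ∀ X Y → Avoids132List (X ++ Y) → Avoids132List Y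
Avoids132List-++⁻ʳ []      Y av       = av
Avoids132List-++⁻ʳ (x ∷ X) Y (_ , av) = Avoids132List-++⁻ʳ X Y av

NoAdjFrom-++⁻ˡ : ∀ {x} X Y → NoAdjFrom x (X ++ Y) → NoAdjFrom x X
NoAdjFrom-++⁻ˡ []          Y _          = tt
NoAdjFrom-++⁻ˡ (p ∷ [])    Y _          = tt
NoAdjFrom-++⁻ˡ (p ∷ q ∷ X) Y (¬pq , na) = ¬pq , NoAdjFrom-++⁻ˡ (q ∷ X) Y na

NoAdjList-++⁻ˡ : ∀ X Y → NoAdjList (X ++ Y) → NoAdjList X
NoAdjList-++⁻ˡ []      Y _           = tt
NoAdjList-++⁻ˡ (x ∷ X) Y (nax , na) = NoAdjFrom-++⁻ˡ X Y nax , NoAdjList-++⁻ˡ X Y na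

NoAdjList-++⁻ʳ : ∀ X Y → NoAdjList (X ++ Y) → NoAdjList Y
NoAdjList-++⁻ʳ []      Y na       = na
NoAdjList-++⁻ʳ (x ∷ X) Y (_ , na) = NoAdjList-++⁻ʳ X Y na

Avoids132From⇒no132 : ∀ {x z} Q y S → Avoids132From x (Q ++ y ∷ S) → z ∈ S → ¬ (x < z × z < y)
Avoids132From⇒no132 []      y S (avy , _) z∈ = All.lookup avy z∈
Avoids132From⇒no132 (q ∷ Q) y S (_ , av)  z∈ = Avoids132From⇒no132 Q y S av z∈

Avoids132List⇒no132 : ∀ {x z} P y S → Avoids132List (P ++ y ∷ S) → x ∈ P → z ∈ S →
  ¬ (x < z × z < y)
Avoids132List⇒no132 (p ∷ P) y S (avp , _) (here refl) z∈ = Avoids132From⇒no132 P y S avp z∈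
Avoids132List⇒no132 (p ∷ P) y S (_ , av)  (there x∈)  z∈ = Avoids132List⇒no132 P y S av x∈ z∈

NoAdjFrom⇒noRise : ∀ {x} Q y z S → NoAdjFrom x (Q ++ y ∷ z ∷ S) → ¬ (x < y × y < z)
NoAdjFrom⇒noRise []           y z S (¬xyz , _) = ¬xyz
NoAdjFrom⇒noRise (q ∷ [])     y z S (_ , na)   = NoAdjFrom⇒noRise [] y z S na
NoAdjFrom⇒noRise (q ∷ q′ ∷ Q) y z S (_ , na)   = NoAdjFrom⇒noRise (q′ ∷ Q) y z S na

NoAdjList⇒noRise : ∀ {x} P y z S → NoAdjList (P ++ y ∷ z ∷ S) → x ∈ P → ¬ (x < y × y < z)
NoAdjList⇒noRise (p ∷ P) y z S (nap , _) (here refl) = NoAdjFrom⇒noRise P y z S nap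
NoAdjList⇒noRise (p ∷ P) y z S (_ , na)  (there x∈)  = NoAdjList⇒noRise P y z S na x∈

raise : ℕ → List ℕ → List ℕ
raise c = map (c +_)

module _ (c : ℕ) where

  Avoids132From-raise⁺ : ∀ {x} ys → Avoids132From x ys → Avoids132From (c + x) (raise c ys)
  Avoids132From-raise⁺ []       _           = tt
  Avoids132From-raise⁺ (y ∷ ys) (avy , av) =
    Allₚ.map⁺ (All.map (λ ¬xzy (x<z , z<y) → ¬xzy (+-cancelˡ-< c _ _ x<z , +-cancelˡ-< c _ _ z<y)) avy) ,
    Avoids132From-raise⁺ ys av

  Avoids132From-raise⁻ : ∀ {x} ys → Avoids132From (c + x) (raise c ys) → Avoids132From x ys
  Avoids132From-raise⁻ []       _           = tt
  Avoids132From-raise⁻ (y ∷ ys) (avy , av) =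
    All.map (λ ¬xzy (x<z , z<y) → ¬xzy (+-monoʳ-< c x<z , +-monoʳ-< c z<y)) (Allₚ.map⁻ avy) ,
    Avoids132From-raise⁻ ys av

  Avoids132List-raise⁺ : ∀ ys → Avoids132List ys → Avoids132List (raise c ys)
  Avoids132List-raise⁺ []       _           = tt
  Avoids132List-raise⁺ (y ∷ ys) (avy , av) = Avoids132From-raise⁺ ys avy , Avoids132List-raise⁺ ys av

  Avoids132List-raise⁻ : ∀ ys → Avoids132List (raise c ys) → Avoids132List ys
  Avoids132List-raise⁻ []       _           = tt
  Avoids132List-raise⁻ (y ∷ ys) (avy , av) = Avoids132From-raise⁻ ys avy , Avoids132List-raise⁻ ys av

  NoAdjFrom-raise⁺ : ∀ {x} ys → NoAdjFrom x ys → NoAdjFrom (c + x) (raise c ys)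
  NoAdjFrom-raise⁺ []           _           = tt
  NoAdjFrom-raise⁺ (y ∷ [])     _           = tt
  NoAdjFrom-raise⁺ (y ∷ z ∷ zs) (¬xyz , na) =
    (λ (x<y , y<z) → ¬xyz (+-cancelˡ-< c _ _ x<y , +-cancelˡ-< c _ _ y<z)) , NoAdjFrom-raise⁺ (z ∷ zs) na

  NoAdjFrom-raise⁻ : ∀ {x} ys → NoAdjFrom (c + x) (raise c ys) → NoAdjFrom x ys
  NoAdjFrom-raise⁻ []           _           = tt
  NoAdjFrom-raise⁻ (y ∷ [])     _           = tt
  NoAdjFrom-raise⁻ (y ∷ z ∷ zs) (¬xyz , na) =
    (λ (x<y , y<z) → ¬xyz (+-monoʳ-< c x<y , +-monoʳ-< c y<z)) , NoAdjFrom-raise⁻ (z ∷ zs) na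

  NoAdjList-raise⁺ : ∀ ys → NoAdjList ys → NoAdjList (raise c ys)
  NoAdjList-raise⁺ []       _           = tt
  NoAdjList-raise⁺ (y ∷ ys) (nay , na) = NoAdjFrom-raise⁺ ys nay , NoAdjList-raise⁺ ys na

  NoAdjList-raise⁻ : ∀ ys → NoAdjList (raise c ys) → NoAdjList ys
  NoAdjList-raise⁻ []       _           = tt
  NoAdjList-raise⁻ (y ∷ ys) (nay , na) = NoAdjFrom-raise⁻ ys nay , NoAdjList-raise⁻ ys na

  countAbove-raise : ∀ x ys → countAbove (c + x) (raise c ys) ≡ countAbove x ys
  countAbove-raise x ys = trans (length-filter-map ((c + x) <?_) (c +_) ys)
    (length-filter-cong (λ y → (c + x) <? (c + y)) (x <?_) ys λ y _ → +-cancelˡ-< c x y , +-monoʳ-< c)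

  frList-raise : ∀ ys → frList (raise c ys) ≡ frList ys
  frList-raise []       = refl
  frList-raise (y ∷ ys) = cong₂ _+_ (countAbove-raise y ys) (frList-raise ys)

  raise-injective : ∀ {xs ys} → raise c xs ≡ raise c ys → xs ≡ ys
  raise-injective {[]}     {[]}     _  = refl
  raise-injective {x ∷ xs} {y ∷ ys} eq with cx≡cy , eq′ ← ∷-injective eq =
    cong₂ _∷_ (+-cancelˡ-≡ c x y cx≡cy) (raise-injective eq′)

  raise-lower : ∀ xs → All (c ≤_) xs → raise c (map (_∸ c) xs) ≡ xs
  raise-lower []       _             = refl
  raise-lower (x ∷ xs) (c≤x ∷ c≤xs) = cong₂ _∷_ (m+[n∸m]≡n c≤x) (raise-lower xs c≤xs)

Unique-++⇒≢ : ∀ {x z : ℕ} P S → Unique (P ++ S) → x ∈ P → z ∈ S → x ≢ z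
Unique-++⇒≢ (p ∷ P) S (p∉ ∷ _) (here refl) z∈ = All.lookup p∉ (∈-++⁺ʳ P z∈)
Unique-++⇒≢ (p ∷ P) S (_ ∷ u)  (there x∈)  z∈ = Unique-++⇒≢ P S u x∈ z∈

Unique-++⁻ˡ : ∀ (P S : List ℕ) → Unique (P ++ S) → Unique P
Unique-++⁻ˡ []      S _          = []
Unique-++⁻ˡ (p ∷ P) S (p∉ ∷ u) = Allₚ.++⁻ˡ P p∉ ∷ Unique-++⁻ˡ P S u

Unique-++⁻ʳ : ∀ (P S : List ℕ) → Unique (P ++ S) → Unique S
Unique-++⁻ʳ []      S u       = u
Unique-++⁻ʳ (p ∷ P) S (_ ∷ u) = Unique-++⁻ʳ P S u

Unique-bounded⇒length≤ : ∀ {xs} lo hi → Unique xs → All (λ x → lo ≤ x × x < hi) xs →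
  length xs ≤ hi ∸ lo
Unique-bounded⇒length≤ {xs} lo hi xs! bounded =
  subst (length xs ≤_) (length-applyUpTo (lo +_) (hi ∸ lo)) (Unique-⊆⇒length≤ xs! xs⊆range)
  where
  xs⊆range : xs ⊆ applyUpTo (lo +_) (hi ∸ lo)
  xs⊆range {x} x∈ with lo≤x , x<hi ← All.lookup bounded x∈ =
    subst (_∈ applyUpTo (lo +_) (hi ∸ lo)) (m+[n∸m]≡n lo≤x)
          (∈-applyUpTo⁺ (lo +_) (∸-monoˡ-< x<hi lo≤x))

∉-++-∷-injective : ∀ {x : ℕ} P P′ {S S′} → x ∉ P → x ∉ P′ → P ++ x ∷ S ≡ P′ ++ x ∷ S′ →
  P ≡ P′ × S ≡ S′
∉-++-∷-injective []      []       _    _     refl = refl , refl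
∉-++-∷-injective []      (p ∷ P′) _    x∉P′ eq   = ⊥-elim (x∉P′ (here (proj₁ (∷-injective eq))))
∉-++-∷-injective (p ∷ P) []       x∉P  _    eq   = ⊥-elim (x∉P (here (sym (proj₁ (∷-injective eq)))))
∉-++-∷-injective (p ∷ P) (p′ ∷ P′) x∉P x∉P′ eq with refl , eq′ ← ∷-injective eq
  with refl , refl ← ∉-++-∷-injective P P′ (x∉P ∘ there) (x∉P′ ∘ there) eq′ = refl , refl

-- Avoids132, NoAdj and fr of Defs for values in ℕ: for π : Fin n → Fin n,
-- Avoids132 π, NoAdj π and fr π are definitionally these applied to toℕ ∘ π.

Avoids132ℕ : ∀ {n} → (Fin n → ℕ) → Set
Avoids132ℕ {n} f = ∀ (i j k : Fin n) → i F.< j → j F.< k → f i < f k → f k < f j → ⊥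

NoAdjℕ : ∀ {n} → (Fin n → ℕ) → Set
NoAdjℕ {n} f = ∀ (a b c : Fin n) → a F.< b → toℕ c ≡ suc (toℕ b) → f a < f b → f b < f c → ⊥

increasingPair? : ∀ {n} (f : Fin n → ℕ) (p : Fin n × Fin n) →
  Dec ((proj₁ p F.< proj₂ p) × (f (proj₁ p) < f (proj₂ p)))
increasingPair? f p = (proj₁ p FP.<? proj₂ p) ×-dec (f (proj₁ p) <? f (proj₂ p))

frℕ : ∀ {n} → (Fin n → ℕ) → ℕ
frℕ {n} f = length (filter (increasingPair? f) (cartesianProduct (allFin n) (allFin n)))

increasingPairsFrom : ∀ {n} (f : Fin n → ℕ) → Fin n → ℕ
increasingPairsFrom {n} f i = length (filter (λ j → increasingPair? f (i , j)) (allFin n))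

Avoids132From-tabulate⁺ : ∀ {n} x (f : Fin n → ℕ) →
  (∀ j k → j F.< k → x < f k → f k < f j → ⊥) → Avoids132From x (tabulate f)
Avoids132From-tabulate⁺ {zero}  x f _   = tt
Avoids132From-tabulate⁺ {suc n} x f no132 =
  Allₚ.tabulate⁺ (λ k (x<fk , fk<f₀) → no132 zero (suc k) z<s x<fk fk<f₀) ,
  Avoids132From-tabulate⁺ x (f ∘ suc) (λ j k j<k → no132 (suc j) (suc k) (s≤s j<k))

Avoids132From-tabulate⁻ : ∀ {n} x (f : Fin n → ℕ) →
  Avoids132From x (tabulate f) → ∀ j k → j F.< k → x < f k → f k < f j → ⊥
Avoids132From-tabulate⁻ x f (av₀ , _) zero    (suc k) _         x<fk fk<f₀ =
  Allₚ.tabulate⁻ av₀ k (x<fk , fk<f₀)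
Avoids132From-tabulate⁻ x f (_ , av)  (suc j) (suc k) (s≤s j<k) =
  Avoids132From-tabulate⁻ x (f ∘ suc) av j k j<k

Avoids132List-tabulate⁺ : ∀ {n} (f : Fin n → ℕ) → Avoids132ℕ f → Avoids132List (tabulate f)
Avoids132List-tabulate⁺ {zero}  f _     = tt
Avoids132List-tabulate⁺ {suc n} f no132 =
  Avoids132From-tabulate⁺ (f zero) (f ∘ suc) (λ j k j<k → no132 zero (suc j) (suc k) z<s (s≤s j<k)) ,
  Avoids132List-tabulate⁺ (f ∘ suc) (λ i j k i<j j<k → no132 (suc i) (suc j) (suc k) (s≤s i<j) (s≤s j<k))

Avoids132List-tabulate⁻ : ∀ {n} (f : Fin n → ℕ) → Avoids132List (tabulate f) → Avoids132ℕ f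
Avoids132List-tabulate⁻ f (av₀ , _) zero    (suc j) (suc k) _         (s≤s j<k) =
  Avoids132From-tabulate⁻ (f zero) (f ∘ suc) av₀ j k j<k
Avoids132List-tabulate⁻ f (_ , av)  (suc i) (suc j) (suc k) (s≤s i<j) (s≤s j<k) =
  Avoids132List-tabulate⁻ (f ∘ suc) av i j k i<j j<k

NoAdjFrom-tabulate⁺ : ∀ {n} x (f : Fin n → ℕ) →
  (∀ b c → toℕ c ≡ suc (toℕ b) → x < f b → f b < f c → ⊥) → NoAdjFrom x (tabulate f)
NoAdjFrom-tabulate⁺ {zero}        x f _      = tt
NoAdjFrom-tabulate⁺ {suc zero}    x f _      = tt
NoAdjFrom-tabulate⁺ {suc (suc n)} x f noRise =
  (λ (x<f₀ , f₀<f₁) → noRise zero (suc zero) refl x<f₀ f₀<f₁) ,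
  NoAdjFrom-tabulate⁺ x (f ∘ suc) (λ b c c≡1+b → noRise (suc b) (suc c) (cong suc c≡1+b))

NoAdjFrom-tabulate⁻ : ∀ {n} x (f : Fin n → ℕ) →
  NoAdjFrom x (tabulate f) → ∀ b c → toℕ c ≡ suc (toℕ b) → x < f b → f b < f c → ⊥
NoAdjFrom-tabulate⁻ {suc (suc n)} x f (¬x<f₀<f₁ , _) zero    (suc zero) refl   x<f₀ f₀<f₁ =
  ¬x<f₀<f₁ (x<f₀ , f₀<f₁)
NoAdjFrom-tabulate⁻ {suc (suc n)} x f (_ , na)       (suc b) (suc c)    c≡1+b =
  NoAdjFrom-tabulate⁻ x (f ∘ suc) na b c (suc-injective c≡1+b)

NoAdjList-tabulate⁺ : ∀ {n} (f : Fin n → ℕ) → NoAdjℕ f → NoAdjList (tabulate f)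
NoAdjList-tabulate⁺ {zero}  f _      = tt
NoAdjList-tabulate⁺ {suc n} f noRise =
  NoAdjFrom-tabulate⁺ (f zero) (f ∘ suc) (λ b c c≡1+b → noRise zero (suc b) (suc c) z<s (cong suc c≡1+b)) ,
  NoAdjList-tabulate⁺ (f ∘ suc)
    (λ a b c a<b c≡1+b → noRise (suc a) (suc b) (suc c) (s≤s a<b) (cong suc c≡1+b))

NoAdjList-tabulate⁻ : ∀ {n} (f : Fin n → ℕ) → NoAdjList (tabulate f) → NoAdjℕ f
NoAdjList-tabulate⁻ f (na₀ , _) zero    (suc b) (suc c) _         c≡1+b =
  NoAdjFrom-tabulate⁻ (f zero) (f ∘ suc) na₀ b c (suc-injective c≡1+b)
NoAdjList-tabulate⁻ f (_ , na)  (suc a) (suc b) (suc c) (s≤s a<b) c≡1+b =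
  NoAdjList-tabulate⁻ (f ∘ suc) na a b c a<b (suc-injective c≡1+b)

module _ {n} (f : Fin (suc n) → ℕ) where

  increasingPairsFrom-zero : increasingPairsFrom f zero ≡ countAbove (f zero) (tabulate (f ∘ suc))
  increasingPairsFrom-zero = begin
    length (filter (λ j → increasingPair? f (zero , j)) (zero ∷ tabulate suc))
      ≡⟨ cong length (filter-reject (λ j → increasingPair? f (zero , j)) {xs = tabulate suc}
                                    (λ (0<0 , _) → <-irrefl refl 0<0)) ⟩
    length (filter (λ j → increasingPair? f (zero , j)) (tabulate suc))
      ≡⟨ length-filter-tabulate (λ j → increasingPair? f (zero , j)) suc ⟩
    length (filter (λ j → increasingPair? f (zero , suc j)) (allFin n))
      ≡⟨ length-filter-cong _ (λ j → f zero <? f (suc j)) (allFin n) (λ _ _ → proj₂ , (z<s ,_)) ⟩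
    length (filter (λ j → f zero <? f (suc j)) (allFin n))
      ≡⟨ length-filter-tabulate (f zero <?_) (f ∘ suc) ⟨
    countAbove (f zero) (tabulate (f ∘ suc)) ∎
    where open ≡-Reasoning

  increasingPairsFrom-suc : ∀ i → increasingPairsFrom f (suc i) ≡ increasingPairsFrom (f ∘ suc) i
  increasingPairsFrom-suc i = begin
    length (filter (λ j → increasingPair? f (suc i , j)) (zero ∷ tabulate suc))
      ≡⟨ cong length (filter-reject (λ j → increasingPair? f (suc i , j)) {xs = tabulate suc}
                                    (λ (i<0 , _) → <⇒≱ i<0 z≤n)) ⟩
    length (filter (λ j → increasingPair? f (suc i , j)) (tabulate suc))
      ≡⟨ length-filter-tabulate (λ j → increasingPair? f (suc i , j)) suc ⟩
    length (filter (λ j → increasingPair? f (suc i , suc j)) (allFin n))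
      ≡⟨ length-filter-cong _ _ (allFin n) (λ _ _ → (λ (i<j , fi<fj) → s≤s⁻¹ i<j , fi<fj)
                                                 , (λ (i<j , fi<fj) → s≤s i<j , fi<fj)) ⟩
    increasingPairsFrom (f ∘ suc) i ∎
    where open ≡-Reasoning

frℕ-tabulate : ∀ {n} (f : Fin n → ℕ) → frℕ f ≡ frList (tabulate f)
frℕ-tabulate {zero}  f = refl
frℕ-tabulate {suc n} f = begin
  frℕ f
    ≡⟨ length-filter-cartesianProduct (increasingPair? f) (allFin (suc n)) (allFin (suc n)) ⟩
  increasingPairsFrom f zero + sum (map (increasingPairsFrom f) (tabulate suc))
    ≡⟨ cong₂ _+_ (increasingPairsFrom-zero f)
                 (cong sum (trans (map-tabulate suc (increasingPairsFrom f))
                                  (tabulate-cong (increasingPairsFrom-suc f)))) ⟩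
  countAbove (f zero) (tabulate (f ∘ suc)) + sum (tabulate (increasingPairsFrom (f ∘ suc)))
    ≡⟨ cong (countAbove (f zero) (tabulate (f ∘ suc)) +_)
         (trans (cong sum (sym (map-tabulate (λ i → i) (increasingPairsFrom (f ∘ suc)))))
                (sym (length-filter-cartesianProduct (increasingPair? (f ∘ suc)) (allFin n) (allFin n)))) ⟩
  countAbove (f zero) (tabulate (f ∘ suc)) + frℕ (f ∘ suc)
    ≡⟨ cong (countAbove (f zero) (tabulate (f ∘ suc)) +_) (frℕ-tabulate (f ∘ suc)) ⟩
  frList (tabulate f) ∎
  where open ≡-Reasoning

IsMotzkin⇒IsMotzkinList : ∀ {n} (π : Fin n → Fin n) → IsMotzkin π →
  IsMotzkinList n (tabulate (toℕ ∘ π))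
IsMotzkin⇒IsMotzkinList π (π-inj , av , na) =
  length-tabulate (toℕ ∘ π) , Allₚ.tabulate⁺ (FP.toℕ<n ∘ π) ,
  Uniqueₚ.tabulate⁺ (π-inj _ _ ∘ FP.toℕ-injective) ,
  Avoids132List-tabulate⁺ (toℕ ∘ π) av , NoAdjList-tabulate⁺ (toℕ ∘ π) na

IsMotzkinList⇒IsMotzkin : ∀ {n} (π : Fin n → Fin n) → IsMotzkinList n (tabulate (toℕ ∘ π)) →
  IsMotzkin π
IsMotzkinList⇒IsMotzkin π (_ , _ , π! , av , na) =
  (λ i j → Unique-tabulate⁻ π! i j ∘ cong toℕ) ,
  Avoids132List-tabulate⁻ (toℕ ∘ π) av , NoAdjList-tabulate⁻ (toℕ ∘ π) na

values : ∀ {m n} → Vec (Fin m) n → List ℕ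
values v = tabulate (toℕ ∘ V.lookup v)

values-injective : ∀ {m n} {v w : Vec (Fin m) n} → values v ≡ values w → v ≡ w
values-injective {v = []}    {[]}    _  = refl
values-injective {v = x ∷ v} {y ∷ w} eq with x≡y , eq′ ← ∷-injective eq =
  cong₂ _∷_ (FP.toℕ-injective x≡y) (values-injective eq′)

values-surjective : ∀ {m} n l → length l ≡ n → All (_< m) l → ∃ λ (v : Vec (Fin m) n) → values v ≡ l
values-surjective zero    []      _  _            = [] , refl
values-surjective (suc n) (x ∷ l) eq (x<m ∷ l<m)
  with v , refl ← values-surjective n l (suc-injective eq) l<m =
  F.fromℕ< x<m ∷ v , cong (_∷ values v) (FP.toℕ-fromℕ< x<m)

∈-words : ∀ m n (v : Vec (Fin n) m) → v ∈ words m n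
∈-words zero    n []      = here refl
∈-words (suc m) n (x ∷ v) =
  ∈-concat⁺′ (∈-map⁺ (_∷ v) (∈-allFin x))
             (∈-map⁺ (λ w → map (_∷ w) (allFin n)) (∈-words m n v))

Unique-words : ∀ m n → Unique (words m n)
Unique-words zero    n = [] ∷ []
Unique-words (suc m) n = Uniqueₚ.concat⁺
  (Allₚ.map⁺ (All.universal (λ _ → Uniqueₚ.map⁺ Vecₚ.∷-injectiveˡ (Uniqueₚ.allFin⁺ n)) _))
  (AllPairsₚ.map⁺ (AllPairs.map disjoint (Unique-words m n)))
  where
  disjoint : ∀ {v w} → v ≢ w → Disjoint (map (_∷ v) (allFin n)) (map (_∷ w) (allFin n))
  disjoint v≢w (z∈ , z∈′) with _ , _ , refl ← ∈-map⁻ _ z∈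
                          with _ , _ , eq ← ∈-map⁻ _ z∈′ = v≢w (Vecₚ.∷-injectiveʳ eq)

-- Enumerating 𝔐_n by the decomposition at the maximum

-- motzkinLists f n lists 𝔐_n as sequences of the values 0, …, n - 1; the fuel f must be ≥ n,
-- below that the list is cut short.

assemble : ℕ → ℕ → List ℕ × List ℕ → List ℕ
assemble b M (α , β) = raise (suc b) α ++ b ∷ M ∷ β

assemblyBlock : (ℕ → List (List ℕ)) → ℕ → ℕ → List (List ℕ)
assemblyBlock G n a = map (assemble (n ∸ a) (suc n)) (cartesianProduct (G a) (G (n ∸ a)))

assembliesUpTo : (ℕ → List (List ℕ)) → ℕ → ℕ → List (List ℕ)
assembliesUpTo G n zero    = assemblyBlock G n zero
assembliesUpTo G n (suc r) = assembliesUpTo G n r ++ assemblyBlock G n (suc r)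

assemblies : (ℕ → List (List ℕ)) → ℕ → List (List ℕ)
assemblies G zero    = []
assemblies G (suc n) = assembliesUpTo G n n

motzkinLists : ℕ → ℕ → List (List ℕ)
motzkinLists f       zero    = [ [] ]
motzkinLists zero    (suc n) = []
motzkinLists (suc f) (suc n) = map (n ∷_) (motzkinLists f n) ++ assemblies (motzkinLists f) n

∈-assemblyBlock⁻ : ∀ G n a {l} → l ∈ assemblyBlock G n a →
  ∃₂ λ α β → α ∈ G a × β ∈ G (n ∸ a) × l ≡ assemble (n ∸ a) (suc n) (α , β)
∈-assemblyBlock⁻ G n a l∈ with (α , β) , αβ∈ , refl ← ∈-map⁻ (assemble (n ∸ a) (suc n)) l∈
  with α∈ , β∈ ← ∈-cartesianProduct⁻ (G a) (G (n ∸ a)) αβ∈ = α , β , α∈ , β∈ , refl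

∈-assemblyBlock⁺ : ∀ G a b {α β} → α ∈ G a → β ∈ G b →
  assemble b (suc (a + b)) (α , β) ∈ assemblyBlock G (a + b) a
∈-assemblyBlock⁺ G a b {α} {β} α∈ β∈ =
  subst (λ c → assemble c (suc (a + b)) (α , β) ∈ assemblyBlock G (a + b) a) (m+n∸m≡n a b)
        (∈-map⁺ (assemble (a + b ∸ a) (suc (a + b)))
                (∈-cartesianProduct⁺ α∈ (subst (λ c → β ∈ G c) (sym (m+n∸m≡n a b)) β∈)))

∈-assembliesUpTo⁻ : ∀ G n r {l} → l ∈ assembliesUpTo G n r →
  ∃ λ a → a ≤ r × l ∈ assemblyBlock G n a
∈-assembliesUpTo⁻ G n zero    l∈ = 0 , z≤n , l∈
∈-assembliesUpTo⁻ G n (suc r) l∈ with ∈-++⁻ (assembliesUpTo G n r) l∈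
... | inj₂ l∈block = suc r , ≤-refl , l∈block
... | inj₁ l∈r with a , a≤r , l∈block ← ∈-assembliesUpTo⁻ G n r l∈r =
  a , m≤n⇒m≤1+n a≤r , l∈block

∈-assembliesUpTo⁺ : ∀ G n r {a l} → a ≤ r → l ∈ assemblyBlock G n a → l ∈ assembliesUpTo G n r
∈-assembliesUpTo⁺ G n zero    z≤n   l∈ = l∈
∈-assembliesUpTo⁺ G n (suc r) a≤1+r l∈ with m≤n⇒m<n∨m≡n a≤1+r
... | inj₂ refl      = ∈-++⁺ʳ (assembliesUpTo G n r) l∈
... | inj₁ (s≤s a≤r) = ∈-++⁺ˡ (∈-assembliesUpTo⁺ G n r a≤r l∈)

IsMotzkinList-∷ : ∀ n β → IsMotzkinList n β → IsMotzkinList (suc n) (n ∷ β)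
IsMotzkinList-∷ n β (len , β<n , β! , av , na) =
  cong suc len , n<1+n n ∷ All.map m<n⇒m<1+n β<n , All.map (λ x<n → ≢-sym (<⇒≢ x<n)) β<n ∷ β! ,
  (Avoids132From-below β β≤n , av) , (NoAdjFrom-below β β≤n , na)
  where β≤n = All.map <⇒≤ β<n

raise-between : ∀ a b α → All (_< a) α → All (λ x → b < x × x < suc (a + b)) (raise (suc b) α)
raise-between a b α α<a = Allₚ.map⁺ (All.map (λ {y} y<a → s≤s (m≤m+n b y) ,
  subst (suc (b + y) <_) (cong suc (+-comm b a)) (+-monoʳ-< (suc b) y<a)) α<a)

module _ {b M} (b<M : b < M) X β (X-between : All (λ x → b < x × x < M) X) (β<b : All (_< b) β) where

  private
    b<X : ∀ {x} → x ∈ X → b < x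
    b<X = proj₁ ∘ All.lookup X-between
    X<M : ∀ {x} → x ∈ X → x < M
    X<M = proj₂ ∘ All.lookup X-between
    β≤ : ∀ {x} → b ≤ x → All (_≤ x) β
    β≤ b≤x = All.map (λ z<b → ≤-trans (<⇒≤ z<b) b≤x) β<b

  Unique-assemble : Unique X → Unique β → Unique (X ++ b ∷ M ∷ β)
  Unique-assemble X! β! = Uniqueₚ.++⁺ X!
    ((<⇒≢ b<M ∷ All.map (≢-sym ∘ <⇒≢) β<b) ∷ All.map (λ z<b → ≢-sym (<⇒≢ (<-trans z<b b<M))) β<b ∷ β!)
    disjoint
    where
    disjoint : ∀ {v} → ¬ (v ∈ X × v ∈ b ∷ M ∷ β)
    disjoint (v∈X , here refl)          = <-irrefl refl (b<X v∈X)
    disjoint (v∈X , there (here refl))  = <-irrefl refl (X<M v∈X)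
    disjoint (v∈X , there (there v∈β)) = <-asym (b<X v∈X) (All.lookup β<b v∈β)

  Avoids132List-assemble : Avoids132List X → Avoids132List β → Avoids132List (X ++ b ∷ M ∷ β)
  Avoids132List-assemble avX avβ = Avoids132List-++ X (b ∷ M ∷ β) avX
    (Avoids132From-∷-below M β (β≤ ≤-refl) , Avoids132From-below β (β≤ (<⇒≤ b<M)) , avβ)
    (λ x∈ → All.universal (λ _ (x<z , z<b) → <-asym (b<X x∈) (<-trans x<z z<b)) _ ,
            Avoids132From-∷-below M β (β≤ (<⇒≤ (b<X x∈))))
    cross
    where
    cross : ∀ {x y z} → x ∈ X → y ∈ X → z ∈ b ∷ M ∷ β → ¬ (x < z × z < y)
    cross x∈ _  (here refl)         (x<b , _) = <-asym x<b (b<X x∈)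
    cross _  y∈ (there (here refl)) (_ , M<y) = <-asym M<y (X<M y∈)
    cross x∈ _  (there (there z∈β)) (x<z , _) = <-asym x<z (<-trans (All.lookup β<b z∈β) (b<X x∈))

  NoAdjList-assemble : NoAdjList X → NoAdjList β → NoAdjList (X ++ b ∷ M ∷ β)
  NoAdjList-assemble naX naβ = NoAdjList-++ X b (M ∷ β) naX
    (NoAdjFrom-∷-below M β (β≤ ≤-refl) , NoAdjFrom-below β (β≤ (<⇒≤ b<M)) , naβ)
    (λ x∈ → (λ (x<b , _) → <-asym x<b (b<X x∈)) , NoAdjFrom-∷-below M β (β≤ (<⇒≤ (b<X x∈))))
    (λ _ w∈ (_ , w<b) → <-asym w<b (b<X w∈))

IsMotzkinList-assemble : ∀ a b α β → IsMotzkinList a α → IsMotzkinList b β →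
  IsMotzkinList (suc (suc (a + b))) (assemble b (suc (a + b)) (α , β))
IsMotzkinList-assemble a b α β (lenα , α<a , α! , avα , naα) (lenβ , β<b , β! , avβ , naβ) =
  length-assemble ,
  Allₚ.++⁺ (All.map (m<n⇒m<1+n ∘ proj₂) X-between)
           (m<n⇒m<1+n b<M ∷ n<1+n M ∷ All.map (λ z<b → m<n⇒m<1+n (<-trans z<b b<M)) β<b) ,
  Unique-assemble b<M X β X-between β<b (Uniqueₚ.map⁺ (+-cancelˡ-≡ (suc b) _ _) α!) β! ,
  Avoids132List-assemble b<M X β X-between β<b (Avoids132List-raise⁺ (suc b) α avα) avβ ,
  NoAdjList-assemble b<M X β X-between β<b (NoAdjList-raise⁺ (suc b) α naα) naβ
  where
  M = suc (a + b)
  X = raise (suc b) α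
  X-between = raise-between a b α α<a
  b<M : b < M
  b<M = s≤s (m≤n+m b a)
  length-assemble : length (X ++ b ∷ M ∷ β) ≡ suc (suc (a + b))
  length-assemble = begin
    length (X ++ b ∷ M ∷ β)
      ≡⟨ length-++ X ⟩
    length X + suc (suc (length β))
      ≡⟨ cong₂ (λ p q → p + suc (suc q)) (trans (length-map (suc b +_) α) lenα) lenβ ⟩
    a + suc (suc b)
      ≡⟨ trans (+-suc a (suc b)) (cong suc (+-suc a b)) ⟩
    suc (suc (a + b)) ∎
    where open ≡-Reasoning

motzkinLists-sound : ∀ f n {l} → l ∈ motzkinLists f n → IsMotzkinList n l
assemblyBlock-sound : ∀ f n a {l} → a ≤ n → l ∈ assemblyBlock (motzkinLists f) n a →
  IsMotzkinList (suc (suc n)) l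

motzkinLists-sound f       zero    (here refl) = refl , [] , [] , tt , tt
motzkinLists-sound (suc f) (suc n) l∈ with ∈-++⁻ (map (n ∷_) (motzkinLists f n)) l∈
... | inj₁ l∈cons with β , β∈ , refl ← ∈-map⁻ (n ∷_) l∈cons =
  IsMotzkinList-∷ n β (motzkinLists-sound f n β∈)
motzkinLists-sound (suc f) (suc (suc n)) l∈ | inj₂ l∈asm
  with a , a≤n , l∈block ← ∈-assembliesUpTo⁻ (motzkinLists f) n n l∈asm =
  assemblyBlock-sound f n a a≤n l∈block

assemblyBlock-sound f n a a≤n l∈ with α , β , α∈ , β∈ , refl ← ∈-assemblyBlock⁻ (motzkinLists f) n a l∈ =
  subst (λ m → IsMotzkinList (suc (suc m)) (assemble (n ∸ a) (suc m) (α , β))) (m+[n∸m]≡n a≤n)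
        (IsMotzkinList-assemble a (n ∸ a) α β (motzkinLists-sound f a α∈)
                                              (motzkinLists-sound f (n ∸ a) β∈))

All<⇒∉ : ∀ {M P} → All (_< M) P → M ∉ P
All<⇒∉ P<M M∈ = <-irrefl refl (All.lookup P<M M∈)

assemble-injective : ∀ {M b b′ α α′ β β′} →
  All (_< M) (raise (suc b) α ++ [ b ]) → All (_< M) (raise (suc b′) α′ ++ [ b′ ]) →
  assemble b M (α , β) ≡ assemble b′ M (α′ , β′) → b ≡ b′ × α ≡ α′ × β ≡ β′
assemble-injective {M} {b} {b′} {α} {α′} {β} {β′} prefix<M prefix′<M eq
  with prefix≡ , refl ← ∉-++-∷-injective (raise (suc b) α ++ [ b ]) (raise (suc b′) α′ ++ [ b′ ])
                          (All<⇒∉ prefix<M) (All<⇒∉ prefix′<M)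
                          (trans (++-assoc (raise (suc b) α) [ b ] (M ∷ β))
                                 (trans eq (sym (++-assoc (raise (suc b′) α′) [ b′ ] (M ∷ β′)))))
  with raise≡ , refl ← ∷ʳ-injective (raise (suc b) α) (raise (suc b′) α′) prefix≡ =
  refl , raise-injective (suc b) raise≡ , refl

assembly-prefix-bounded : ∀ f n a {α} → a ≤ n → α ∈ motzkinLists f a →
  All (_< suc n) (raise (suc (n ∸ a)) α ++ [ n ∸ a ])
assembly-prefix-bounded f n a {α} a≤n α∈ =
  subst (λ m → All (_< suc m) (raise (suc (n ∸ a)) α ++ [ n ∸ a ])) (m+[n∸m]≡n a≤n)
        (Allₚ.++⁺ (All.map proj₂ (raise-between a (n ∸ a) α (proj₁ (proj₂ (motzkinLists-sound f a α∈)))))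
                  (s≤s (m≤n+m (n ∸ a) a) ∷ []))

∈-after-head : ∀ {n : ℕ} {β} X b β′ → n ∷ β ≡ X ++ b ∷ n ∷ β′ → n ∈ β
∈-after-head []      b β′ eq = subst (_ ∈_) (sym (proj₂ (∷-injective eq))) (here refl)
∈-after-head (x ∷ X) b β′ eq =
  subst (_ ∈_) (sym (proj₂ (∷-injective eq))) (∈-++⁺ʳ X (there (here refl)))

Unique-motzkinLists : ∀ f n → Unique (motzkinLists f n)
Unique-assembliesUpTo : ∀ f n r → r ≤ n → Unique (assembliesUpTo (motzkinLists f) n r)
Unique-assemblyBlock : ∀ f n a → a ≤ n → Unique (assemblyBlock (motzkinLists f) n a)

Unique-motzkinLists f       zero    = [] ∷ []
Unique-motzkinLists zero    (suc n) = []
Unique-motzkinLists (suc f) (suc n) =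
  Uniqueₚ.++⁺ (Uniqueₚ.map⁺ (proj₂ ∘ ∷-injective) (Unique-motzkinLists f n)) (Unique-assemblies n) disjoint
  where
  Unique-assemblies : ∀ n → Unique (assemblies (motzkinLists f) n)
  Unique-assemblies zero    = []
  Unique-assemblies (suc n) = Unique-assembliesUpTo f n n ≤-refl
  n∈tail : ∀ n {β} → n ∷ β ∈ assemblies (motzkinLists f) n → n ∈ β
  n∈tail (suc n) l∈ with a , a≤n , l∈block ← ∈-assembliesUpTo⁻ (motzkinLists f) n n l∈
    with α , β′ , _ , _ , eq ← ∈-assemblyBlock⁻ (motzkinLists f) n a l∈block =
    ∈-after-head (raise (suc (n ∸ a)) α) (n ∸ a) β′ eq
  disjoint : ∀ {l} → ¬ (l ∈ map (n ∷_) (motzkinLists f n) × l ∈ assemblies (motzkinLists f) n)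
  disjoint (l∈cons , l∈asm) with β , _ , refl ← ∈-map⁻ (n ∷_) l∈cons
    with _ , _ , n∷β! , _ ← motzkinLists-sound (suc f) (suc n) (∈-++⁺ʳ _ l∈asm) =
    All.lookup (AllPairs.head n∷β!) (n∈tail n l∈asm) refl

Unique-assembliesUpTo f n zero    r≤n = Unique-assemblyBlock f n zero r≤n
Unique-assembliesUpTo f n (suc r) r<n =
  Uniqueₚ.++⁺ (Unique-assembliesUpTo f n r (<⇒≤ r<n)) (Unique-assemblyBlock f n (suc r) r<n) disjoint
  where
  disjoint : ∀ {l} → ¬ (l ∈ assembliesUpTo (motzkinLists f) n r × l ∈ assemblyBlock (motzkinLists f) n (suc r))
  disjoint (l∈ , l∈′) with a , a≤r , l∈block ← ∈-assembliesUpTo⁻ (motzkinLists f) n r l∈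
    with α , β , α∈ , _ , refl ← ∈-assemblyBlock⁻ (motzkinLists f) n a l∈block
    with α′ , β′ , α′∈ , _ , eq ← ∈-assemblyBlock⁻ (motzkinLists f) n (suc r) l∈′
    with a≤n ← ≤-trans a≤r (<⇒≤ r<n)
    with b≡b′ , _ ← assemble-injective (assembly-prefix-bounded f n a a≤n α∈)
                                       (assembly-prefix-bounded f n (suc r) r<n α′∈) eq =
    <-irrefl (∸-cancelˡ-≡ a≤n r<n b≡b′) (s≤s a≤r)

Unique-assemblyBlock f n a a≤n =
  Unique-map⁺-∈ (Uniqueₚ.cartesianProduct⁺ (Unique-motzkinLists f a) (Unique-motzkinLists f (n ∸ a))) injective
  where
  injective : ∀ {p q} → p ∈ cartesianProduct (motzkinLists f a) (motzkinLists f (n ∸ a)) → q ∈ _ →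
    assemble (n ∸ a) (suc n) p ≡ assemble (n ∸ a) (suc n) q → p ≡ q
  injective {α , β} {α′ , β′} p∈ q∈ eq
    with _ , refl , refl ← assemble-injective
           (assembly-prefix-bounded f n a a≤n (proj₁ (∈-cartesianProduct⁻ _ _ p∈)))
           (assembly-prefix-bounded f n a a≤n (proj₁ (∈-cartesianProduct⁻ _ _ q∈))) eq = refl

IsMotzkinList-∷⁻ : ∀ n S → IsMotzkinList (suc n) (n ∷ S) → IsMotzkinList n S
IsMotzkinList-∷⁻ n S (len , _ ∷ S<1+n , n∉S ∷ S! , (_ , av) , (_ , na)) =
  suc-injective len , All.zipWith (λ (z<1+n , n≢z) → ≤∧≢⇒< (s≤s⁻¹ z<1+n) (≢-sym n≢z)) (S<1+n , n∉S) ,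
  S! , av , na

-- With the maximum M in  Q m M S,  132-avoidance puts S below m and the forbidden rise
-- x < m < M puts Q above m.
split-at-max : ∀ {M} Q m S → IsMotzkinList (suc M) (Q ++ m ∷ M ∷ S) →
  All (λ x → m < x × x < M) Q × m < M × All (_< m) S
split-at-max {M} Q m S (_ , l<1+M , l! , av , na) = All.tabulate Q-between , m<M , All.tabulate S<m
  where
  mMS! = Unique-++⁻ʳ Q (m ∷ M ∷ S) l!
  m∉MS = AllPairs.head mMS!
  M∉S = AllPairs.head (AllPairs.tail mMS!)
  m<M : m < M
  m<M = ≤∧≢⇒< (s≤s⁻¹ (All.lookup l<1+M (∈-++⁺ʳ Q (here refl)))) (All.head m∉MS)
  Q-between : ∀ {x} → x ∈ Q → m < x × x < M
  Q-between x∈ =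
    ≤∧≢⇒< (≮⇒≥ (λ x<m → NoAdjList⇒noRise Q m M S na x∈ (x<m , m<M))) (≢-sym (Unique-++⇒≢ Q _ l! x∈ (here refl))) ,
    ≤∧≢⇒< (s≤s⁻¹ (All.lookup l<1+M (∈-++⁺ˡ x∈))) (Unique-++⇒≢ Q _ l! x∈ (there (here refl)))
  S<m : ∀ {z} → z ∈ S → z < m
  S<m z∈ = ≤∧≢⇒< (≮⇒≥ (λ m<z → Avoids132List⇒no132 (Q ++ [ m ]) M S av′ (∈-++⁺ʳ Q (here refl)) z∈ (m<z , z<M)))
                 (λ z≡m → All.lookup m∉MS (there z∈) (sym z≡m))
    where
    av′ = subst Avoids132List (sym (++-assoc Q [ m ] (M ∷ S))) av
    z<M = ≤∧≢⇒< (s≤s⁻¹ (All.lookup l<1+M (∈-++⁺ʳ Q (there (there z∈))))) (λ z≡M → All.lookup M∉S z∈ (sym z≡M))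

-- The entries of S are distinct and below m, those of Q distinct and strictly between m and the
-- maximum; counting both sides gives m = length S.
split-at-max-length : ∀ Q m S → let n = length Q + length S in
  IsMotzkinList (suc (suc n)) (Q ++ m ∷ suc n ∷ S) → m ≡ length S
split-at-max-length Q m S mot@(_ , _ , l! , _) with Q-between , m<M , S<m ← split-at-max Q m S mot =
  ≤-antisym m≤b b≤m
  where
  a = length Q
  b = length S
  b≤m : b ≤ m
  b≤m = Unique-bounded⇒length≤ 0 m (AllPairs.tail (AllPairs.tail (Unique-++⁻ʳ Q _ l!))) (All.map (z≤n ,_) S<m)
  a≤a+b∸m : a ≤ a + b ∸ m
  a≤a+b∸m = Unique-bounded⇒length≤ (suc m) (suc (a + b)) (Unique-++⁻ˡ Q _ l!) Q-between
  m≤b : m ≤ b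
  m≤b = +-cancelˡ-≤ a m b (begin
    a + m           ≡⟨ +-comm a m ⟩
    m + a           ≤⟨ +-monoʳ-≤ m a≤a+b∸m ⟩
    m + (a + b ∸ m) ≡⟨ m+[n∸m]≡n (s≤s⁻¹ m<M) ⟩
    a + b           ∎)
    where open ≤-Reasoning

lower : ℕ → List ℕ → List ℕ
lower c = map (_∸ c)

split-at-max-parts : ∀ Q m S → let a = length Q; b = length S in
  IsMotzkinList (suc (suc (a + b))) (Q ++ m ∷ suc (a + b) ∷ S) →
  m ≡ b × raise (suc b) (lower (suc b) Q) ≡ Q × IsMotzkinList a (lower (suc b) Q) × IsMotzkinList b S
split-at-max-parts Q m S mot@(_ , _ , l! , av , na)
  with refl ← split-at-max-length Q m S mot =
  refl , raise-lower≡ ,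
  (length-map (_∸ suc b) Q ,
   Allₚ.map⁺ (All.map (λ (b<x , x<M) → subst (_ <_) (m+n∸n≡m a b) (∸-monoˡ-< x<M b<x)) Q-between) ,
   Uniqueₚ.map⁻ (subst Unique (sym raise-lower≡) (Unique-++⁻ˡ Q _ l!)) ,
   Avoids132List-raise⁻ (suc b) α (subst Avoids132List (sym raise-lower≡) (Avoids132List-++⁻ˡ Q _ av)) ,
   NoAdjList-raise⁻ (suc b) α (subst NoAdjList (sym raise-lower≡) (NoAdjList-++⁻ˡ Q _ na))) ,
  (refl , S<b , AllPairs.tail (AllPairs.tail (Unique-++⁻ʳ Q _ l!)) ,
   proj₂ (proj₂ (Avoids132List-++⁻ʳ Q _ av)) , proj₂ (proj₂ (NoAdjList-++⁻ʳ Q _ na)))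
  where
  a = length Q
  b = length S
  α = lower (suc b) Q
  Q-between = proj₁ (split-at-max Q b S mot)
  S<b = proj₂ (proj₂ (split-at-max Q b S mot))
  raise-lower≡ : raise (suc b) α ≡ Q
  raise-lower≡ = raise-lower (suc b) Q (All.map proj₁ Q-between)

∈-assemblies : ∀ f Q m S → let n = length Q + length S in suc n ≤ f →
  (∀ k {l} → k ≤ f → IsMotzkinList k l → l ∈ motzkinLists f k) →
  IsMotzkinList (suc (suc n)) (Q ++ m ∷ suc n ∷ S) →
  Q ++ m ∷ suc n ∷ S ∈ assemblies (motzkinLists f) (suc n)
∈-assemblies f Q m S 1+n≤f complete mot
  with refl , raise-lower≡ , motα , motS ← split-at-max-parts Q m S mot =
  ∈-assembliesUpTo⁺ (motzkinLists f) (a + b) (a + b) (m≤m+n a b)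
    (subst (_∈ assemblyBlock (motzkinLists f) (a + b) a) (cong (_++ b ∷ suc (a + b) ∷ S) raise-lower≡)
      (∈-assemblyBlock⁺ (motzkinLists f) a b (complete a (≤-trans (m≤m+n a b) (<⇒≤ 1+n≤f)) motα)
                                             (complete b (≤-trans (m≤n+m b a) (<⇒≤ 1+n≤f)) motS)))
  where
  a = length Q
  b = length S

length-split⇒max : ∀ Q m n S → length ((Q ∷ʳ m) ++ n ∷ S) ≡ suc n → n ≡ suc (length Q + length S)
length-split⇒max Q m n S len = suc-injective (begin
  suc n                                ≡⟨ len ⟨
  length ((Q ∷ʳ m) ++ n ∷ S)           ≡⟨ length-++ (Q ∷ʳ m) ⟩
  length (Q ++ [ m ]) + suc (length S) ≡⟨ cong (_+ suc (length S)) (length-++ Q) ⟩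
  length Q + 1 + suc (length S)        ≡⟨ +-1-suc (length Q) (length S) ⟩
  suc (suc (length Q + length S))      ∎)
  where
  open ≡-Reasoning
  +-1-suc : ∀ a b → a + 1 + suc b ≡ suc (suc (a + b))
  +-1-suc = solve-∀

motzkinLists-complete : ∀ f n {l} → n ≤ f → IsMotzkinList n l → l ∈ motzkinLists f n
motzkinLists-complete f       zero    {[]}    _ _ = here refl
motzkinLists-complete (suc f) (suc n) {l} (s≤s n≤f) mot@(len , l<1+n , l! , _) with n ∈? l
... | no n∉l = ⊥-elim (<-irrefl len (s≤s (Unique-bounded⇒length≤ 0 n l! (All.tabulate (λ x∈ → z≤n , x<n x∈)))))
  where
  x<n : ∀ {x} → x ∈ l → x < n
  x<n x∈ = ≤∧≢⇒< (s≤s⁻¹ (All.lookup l<1+n x∈)) (λ { refl → n∉l x∈ })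
... | yes n∈l with P , S , refl ← ∈-∃++ n∈l with initLast P
...   | [] = ∈-++⁺ˡ (∈-map⁺ (n ∷_) (motzkinLists-complete f n n≤f (IsMotzkinList-∷⁻ n S mot)))
...   | Q ∷ʳ′ m with refl ← length-split⇒max Q m n S len =
  ∈-++⁺ʳ (map (n ∷_) (motzkinLists f n))
    (subst (_∈ assemblies (motzkinLists f) n) (sym (++-assoc Q [ m ] (n ∷ S)))
      (∈-assemblies f Q m S n≤f (motzkinLists-complete f)
                    (subst (IsMotzkinList (suc n)) (++-assoc Q [ m ] (n ∷ S)) mot)))

-- The statistic fr and the recursion for M(x q^i, q)

countAbove-∷-< : ∀ {x y} ys → x < y → countAbove x (y ∷ ys) ≡ suc (countAbove x ys)
countAbove-∷-< {x} ys x<y = cong length (filter-accept (x <?_) {xs = ys} x<y)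

countAbove-∷-≮ : ∀ {x y} ys → ¬ x < y → countAbove x (y ∷ ys) ≡ countAbove x ys
countAbove-∷-≮ {x} ys x≮y = cong length (filter-reject (x <?_) {xs = ys} x≮y)

countAbove-below : ∀ {x} ys → All (_≤ x) ys → countAbove x ys ≡ 0
countAbove-below {x} ys ys≤x = cong length (filter-none (x <?_) (All.map (λ y≤x x<y → <⇒≱ x<y y≤x) ys≤x))

frList-++ : ∀ X Y → (∀ {x} → x ∈ X → countAbove x Y ≡ 1) → frList (X ++ Y) ≡ frList X + length X + frList Y
frList-++ []      Y _    = refl
frList-++ (x ∷ X) Y once = begin
  countAbove x (X ++ Y) + frList (X ++ Y)
    ≡⟨ cong₂ _+_ (trans (length-filter-++ (x <?_) X Y) (cong (countAbove x X +_) (once (here refl))))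
                 (frList-++ X Y (once ∘ there)) ⟩
  (countAbove x X + 1) + (frList X + length X + frList Y)
    ≡⟨ regroup (countAbove x X) (frList X) (length X) (frList Y) ⟩
  countAbove x X + frList X + suc (length X) + frList Y ∎
  where
  open ≡-Reasoning
  regroup : ∀ c f l r → (c + 1) + (f + l + r) ≡ c + f + suc l + r
  regroup = solve-∀

frList-assemble : ∀ {b M} α β → All (_< M) (raise (suc b) α ++ [ b ]) → All (_< b) β →
  frList (assemble b M (α , β)) ≡ frList α + suc (length α) + frList β
frList-assemble {b} {M} α β prefix<M β<b = begin
  frList (X ++ b ∷ M ∷ β)
    ≡⟨ frList-++ X (b ∷ M ∷ β) once ⟩
  frList X + length X + frList (b ∷ M ∷ β)
    ≡⟨ cong₂ (λ f l → f + l + frList (b ∷ M ∷ β)) (frList-raise (suc b) α) (length-map (suc b +_) α) ⟩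
  frList α + length α + frList (b ∷ M ∷ β)
    ≡⟨ cong (frList α + length α +_)
            (cong₂ _+_ (trans (countAbove-∷-< β b<M) (cong suc (countAbove-below β (β≤ ≤-refl))))
                       (cong (_+ frList β) (countAbove-below β (β≤ (<⇒≤ b<M))))) ⟩
  frList α + length α + suc (frList β)
    ≡⟨ +-suc-middle (frList α) (length α) (frList β) ⟩
  frList α + suc (length α) + frList β ∎
  where
  open ≡-Reasoning
  X = raise (suc b) α
  b<M = All.head (Allₚ.++⁻ʳ X prefix<M)
  β≤ : ∀ {x} → b ≤ x → All (_≤ x) β
  β≤ b≤x = All.map (λ z<b → ≤-trans (<⇒≤ z<b) b≤x) β<b
  once : ∀ {x} → x ∈ X → countAbove x (b ∷ M ∷ β) ≡ 1
  once {x} x∈ with y , _ , refl ← ∈-map⁻ (suc b +_) x∈ = begin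
    countAbove x (b ∷ M ∷ β) ≡⟨ countAbove-∷-≮ (M ∷ β) (λ x<b → <-asym x<b b<x) ⟩
    countAbove x (M ∷ β)     ≡⟨ countAbove-∷-< β (All.lookup (Allₚ.++⁻ˡ X prefix<M) x∈) ⟩
    suc (countAbove x β)     ≡⟨ cong suc (countAbove-below β (β≤ (<⇒≤ b<x))) ⟩
    1                        ∎
    where b<x = s≤s (m≤m+n b y)
  +-suc-middle : ∀ f l r → f + l + suc r ≡ f + suc l + r
  +-suc-middle = solve-∀

countOfWeight-assembliesUpTo : ∀ (w : List ℕ → ℕ) G n r k →
  countOfWeight w (assembliesUpTo G n r) k ≡ sumTo r (λ a → countOfWeight w (assemblyBlock G n a) k)
countOfWeight-assembliesUpTo w G n zero    k = refl
countOfWeight-assembliesUpTo w G n (suc r) k =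
  trans (length-filter-++ (λ l → w l ≟ k) (assembliesUpTo G n r) (assemblyBlock G n (suc r)))
        (cong (_+ countOfWeight w (assemblyBlock G n (suc r)) k) (countOfWeight-assembliesUpTo w G n r k))

weight : ℕ → ℕ → List ℕ → ℕ
weight i n l = i * n + frList l

weight-∷ : ∀ i n β → All (_< n) β → weight i (suc n) (n ∷ β) ≡ weight i n β + i
weight-∷ i n β β<n = begin
  i * suc n + (countAbove n β + frList β)
    ≡⟨ cong (λ c → i * suc n + (c + frList β)) (countAbove-below β (All.map <⇒≤ β<n)) ⟩
  i * suc n + frList β
    ≡⟨ regroup i n (frList β) ⟩
  i * n + frList β + i ∎
  where
  open ≡-Reasoning
  regroup : ∀ i n f → i * suc n + f ≡ i * n + f + i
  regroup = solve-∀

weight-assemble : ∀ i n a {α β} → a ≤ n → length α ≡ a →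
  All (_< suc n) (raise (suc (n ∸ a)) α ++ [ n ∸ a ]) → All (_< n ∸ a) β →
  weight i (suc (suc n)) (assemble (n ∸ a) (suc n) (α , β)) ≡
  weight (suc i) a α + weight i (n ∸ a) β + (2 * i + 1)
weight-assemble i n a {α} {β} a≤n lenα prefix<M β<b = begin
  i * suc (suc n) + frList (assemble (n ∸ a) (suc n) (α , β))
    ≡⟨ cong (i * suc (suc n) +_) (frList-assemble α β prefix<M β<b) ⟩
  i * suc (suc n) + (frList α + suc (length α) + frList β)
    ≡⟨ cong₂ (λ m l → i * suc (suc m) + (frList α + suc l + frList β)) (sym (m+[n∸m]≡n a≤n)) lenα ⟩
  i * suc (suc (a + (n ∸ a))) + (frList α + suc a + frList β)
    ≡⟨ regroup i a (n ∸ a) (frList α) (frList β) ⟩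
  (suc i * a + frList α) + (i * (n ∸ a) + frList β) + (2 * i + 1) ∎
  where
  open ≡-Reasoning
  regroup : ∀ i a b f g → i * suc (suc (a + b)) + (f + suc a + g) ≡ (suc i * a + f) + (i * b + g) + (2 * i + 1)
  regroup = solve-∀

-- [x^n q^k] M(x q^i, q) for the series M(x, q) of the theorem; the weight is written i * n + fr
-- so that scaledCount 0 is motzkinCount by definition.
scaledCount : ℕ → Series
scaledCount i n k =
  length (filter (λ v → isMotzkin? (V.lookup v) ×-dec (i * n + fr (V.lookup v) ≟ k)) (words n n))

scaledCount-motzkinLists : ∀ i n k {f} → n ≤ f →
  scaledCount i n k ≡ countOfWeight (weight i n) (motzkinLists f n) k
scaledCount-motzkinLists i n k {f} n≤f = trans
  (length-filter-cong _ (λ v → isMotzkin? (V.lookup v) ×-dec (weight i n (values v) ≟ k)) (words n n) λ v _ →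
    (λ (mot , eq) → mot , trans (cong (i * n +_) (sym (frℕ-tabulate (toℕ ∘ V.lookup v)))) eq) ,
    (λ (mot , eq) → mot , trans (cong (i * n +_) (frℕ-tabulate (toℕ ∘ V.lookup v))) eq))
  (length-filter-reindex (isMotzkin? ∘ V.lookup) values (words n n) (motzkinLists f n)
    (Unique-words n n) (Unique-motzkinLists f n) values-injective into onto (λ l → weight i n l ≟ k))
  where
  into : ∀ v → v ∈ words n n → IsMotzkin (V.lookup v) → values v ∈ motzkinLists f n
  into v _ mot = motzkinLists-complete f n n≤f (IsMotzkin⇒IsMotzkinList (V.lookup v) mot)
  onto : ∀ l → l ∈ motzkinLists f n → ∃ λ v → v ∈ words n n × IsMotzkin (V.lookup v) × values v ≡ l
  onto l l∈ with mot@(len , l<n , _) ← motzkinLists-sound f n l∈ with v , refl ← values-surjective n l len l<n =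
    v , ∈-words n n v , IsMotzkinList⇒IsMotzkin (V.lookup v) mot , refl

countOfWeight-cons : ∀ i n k →
  countOfWeight (weight i (suc n)) (map (n ∷_) (motzkinLists n n)) k ≡ shift 1 i (scaledCount i) (suc n) k
countOfWeight-cons i n k = shift-by-cases 1 i (scaledCount i) (s≤s z≤n)
  (λ i≤k → trans count≡ (trans (countOfWeight-+ (weight i n) G i k i≤k)
                               (sym (scaledCount-motzkinLists i n (k ∸ i) ≤-refl))))
  (λ k<i → trans count≡ (countOfWeight-+-< (weight i n) G i k k<i))
  where
  G = motzkinLists n n
  count≡ : countOfWeight (weight i (suc n)) (map (n ∷_) G) k ≡ countOfWeight (λ β → weight i n β + i) G k
  count≡ = trans (length-filter-map (λ l → weight i (suc n) l ≟ k) (n ∷_) G)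
                 (countOfWeight-cong G k (λ β∈ → weight-∷ i n _ (proj₁ (proj₂ (motzkinLists-sound n n β∈)))))

countOfWeight-assemblyBlock : ∀ i n a k {f} → a ≤ n →
  countOfWeight (weight i (suc (suc n))) (assemblyBlock (motzkinLists f) n a) k ≡
  countOfWeight (λ p → weight (suc i) a (proj₁ p) + weight i (n ∸ a) (proj₂ p) + (2 * i + 1))
                (cartesianProduct (motzkinLists f a) (motzkinLists f (n ∸ a))) k
countOfWeight-assemblyBlock i n a k {f} a≤n =
  trans (length-filter-map (λ l → weight i (suc (suc n)) l ≟ k) (assemble (n ∸ a) (suc n)) pairs)
        (countOfWeight-cong pairs k weight≡)
  where
  pairs = cartesianProduct (motzkinLists f a) (motzkinLists f (n ∸ a))
  weight≡ : ∀ {p} → p ∈ pairs → weight i (suc (suc n)) (assemble (n ∸ a) (suc n) p) ≡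
                                 weight (suc i) a (proj₁ p) + weight i (n ∸ a) (proj₂ p) + (2 * i + 1)
  weight≡ p∈ with α∈ , β∈ ← ∈-cartesianProduct⁻ (motzkinLists f a) (motzkinLists f (n ∸ a)) p∈ =
    weight-assemble i n a a≤n (proj₁ (motzkinLists-sound f a α∈)) (assembly-prefix-bounded f n a a≤n α∈)
                    (proj₁ (proj₂ (motzkinLists-sound f (n ∸ a) β∈)))

countOfWeight-assemblyBlock-≥ : ∀ i n a k → a ≤ n → 2 * i + 1 ≤ k →
  countOfWeight (weight i (suc (suc n))) (assemblyBlock (motzkinLists (suc n)) n a) k ≡
  sumTo (k ∸ (2 * i + 1)) (λ j → scaledCount (suc i) a j * scaledCount i (n ∸ a) (k ∸ (2 * i + 1) ∸ j))
countOfWeight-assemblyBlock-≥ i n a k a≤n c≤k = begin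
  countOfWeight (weight i (suc (suc n))) (assemblyBlock G n a) k
    ≡⟨ countOfWeight-assemblyBlock i n a k a≤n ⟩
  countOfWeight (λ p → w₁ (proj₁ p) + w₂ (proj₂ p) + c) (cartesianProduct (G a) (G (n ∸ a))) k
    ≡⟨ countOfWeight-+ (λ p → w₁ (proj₁ p) + w₂ (proj₂ p)) (cartesianProduct (G a) (G (n ∸ a))) c k c≤k ⟩
  countOfWeight (λ p → w₁ (proj₁ p) + w₂ (proj₂ p)) (cartesianProduct (G a) (G (n ∸ a))) (k ∸ c)
    ≡⟨ countOfWeight-cartesianProduct w₁ w₂ (G a) (G (n ∸ a)) (k ∸ c) ⟩
  sumTo (k ∸ c) (λ j → countOfWeight w₁ (G a) j * countOfWeight w₂ (G (n ∸ a)) (k ∸ c ∸ j))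
    ≡⟨ sumTo-cong (k ∸ c) (λ j _ →
         cong₂ _*_ (scaledCount-motzkinLists (suc i) a j (m≤n⇒m≤1+n a≤n))
                   (scaledCount-motzkinLists i (n ∸ a) (k ∸ c ∸ j) (m≤n⇒m≤1+n (m∸n≤m n a)))) ⟨
  sumTo (k ∸ c) (λ j → scaledCount (suc i) a j * scaledCount i (n ∸ a) (k ∸ c ∸ j)) ∎
  where
  open ≡-Reasoning
  c = 2 * i + 1
  G = motzkinLists (suc n)
  w₁ = weight (suc i) a
  w₂ = weight i (n ∸ a)

countOfWeight-assemblies : ∀ i n k →
  countOfWeight (weight i (suc n)) (assemblies (motzkinLists n) n) k ≡
  shift 2 (2 * i + 1) (scaledCount (suc i) ⊗ scaledCount i) (suc n) k
countOfWeight-assemblies i zero    k =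
  sym (shift-< 2 (2 * i + 1) (scaledCount (suc i) ⊗ scaledCount i) 1 k (inj₁ (s≤s (s≤s z≤n))))
countOfWeight-assemblies i (suc n) k = trans (countOfWeight-assembliesUpTo W G n n k)
  (shift-by-cases 2 (2 * i + 1) (scaledCount (suc i) ⊗ scaledCount i) (s≤s (s≤s z≤n))
    (λ c≤k → sumTo-cong n λ a a≤n → countOfWeight-assemblyBlock-≥ i n a k a≤n c≤k)
    (λ k<c → sumTo-zero n λ a a≤n →
      trans (countOfWeight-assemblyBlock i n a k a≤n)
            (countOfWeight-+-< (pairWeight a) (cartesianProduct (G a) (G (n ∸ a))) _ k k<c)))
  where
  G = motzkinLists (suc n)
  W = weight i (suc (suc n))
  pairWeight : ∀ a → List ℕ × List ℕ → ℕ
  pairWeight a (α , β) = weight (suc i) a α + weight i (n ∸ a) β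

scaledCount-step : ∀ i n k → scaledCount i n k ≡ cfStep i (scaledCount i) (scaledCount (suc i)) n k
scaledCount-step i zero k = begin
  scaledCount i 0 k                             ≡⟨ scaledCount-motzkinLists i 0 k {0} z≤n ⟩
  countOfWeight (weight i 0) [ [] ] k           ≡⟨ countOfWeight-cong [ [] ] k weight[]≡0 ⟩
  countOfWeight (λ _ → 0) (motzkinLists 0 0) k  ≡⟨ constant-term k ⟩
  cfStep i (scaledCount i) (scaledCount (suc i)) 0 k ∎
  where
  open ≡-Reasoning
  weight[]≡0 : ∀ {l} → l ∈ motzkinLists 0 0 → weight i 0 l ≡ 0
  weight[]≡0 (here refl) = trans (+-identityʳ (i * 0)) (*-zeroʳ i)
  constant-term : ∀ k →
    countOfWeight (λ _ → 0) (motzkinLists 0 0) k ≡ cfStep i (scaledCount i) (scaledCount (suc i)) 0 k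
  constant-term zero    = refl
  constant-term (suc k) = refl
scaledCount-step i (suc n) k = begin
  scaledCount i (suc n) k
    ≡⟨ scaledCount-motzkinLists i (suc n) k ≤-refl ⟩
  countOfWeight W (map (n ∷_) (motzkinLists n n) ++ assemblies (motzkinLists n) n) k
    ≡⟨ length-filter-++ (λ l → W l ≟ k) (map (n ∷_) (motzkinLists n n)) (assemblies (motzkinLists n) n) ⟩
  countOfWeight W (map (n ∷_) (motzkinLists n n)) k + countOfWeight W (assemblies (motzkinLists n) n) k
    ≡⟨ cong₂ _+_ (countOfWeight-cons i n k) (countOfWeight-assemblies i n k) ⟩
  shift 1 i (scaledCount i) (suc n) k + shift 2 (2 * i + 1) (scaledCount (suc i) ⊗ scaledCount i) (suc n) k
    ≡⟨ cong (_+ (shift 1 i (scaledCount i) (suc n) k +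
                 shift 2 (2 * i + 1) (scaledCount (suc i) ⊗ scaledCount i) (suc n) k))
            (mono-≢ 0 0 (suc n) k (inj₁ λ ())) ⟨
  cfStep i (scaledCount i) (scaledCount (suc i)) (suc n) k ∎
  where
  open ≡-Reasoning
  W = weight i (suc n)

corollary3p4 : ∀ (n k : ℕ) → ∃[ D ] (∀ (d : ℕ) → D ≤ d → motzkinCount n k ≡ cf 0 d n k)
corollary3p4 n k = suc n , λ d n<d → sym (cf-approximates scaledCount scaledCount-step (suc n) 0 d n<d ≤-refl k)
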